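{- Let $n=2m\ge6$ and $\mathcal M=\mathrm{CM}(D_n,\,a\langle a^2\rangle\cup b\langle a^2\rangle,\,p)$ with $p=(b,a,a^2b,a^3,a^4b,\ldots,a^{n-2}b,a^{n-1})$ (i.e. $p(a^jb)=a^{j+1}$ for even $j$, $p(a^j)=a^{j+1}b$ for odd $j$). Then: (1) $\mathcal M$ is regular, and its associated skew-morphism $\psi$ is given by $\psi(a^j)=a^{ -j}$ and $\psi(a^jb)=a^{j+1}$ for even $j$, and $\psi(a^j)=a^{j+1}b$ and $\psi(a^jb)=a^{ -j}b$ for odd $j$; (2) if $N\le C_n$ is the subgroup such that $L(N)$ is the core of $L(C_n)$ in $\mathrm{Aut}(\mathcal M)$, then $|N|\le2$, and $|N|=1$ if and only if $m$ is odd; (3) the associated power function $\pi$ satisfies $\mathrm{Ker}(\pi)\cong\mathbb Z_2^2$; (4) $\{\pi(g):g\in D_n\}=\{2i+1: i\in\{0,1,\dots,m-1\}\}$, and if $4\mid n$ then for $x\in D_n$: $\pi(x)\equiv-1\pmod 4$ if and only if $x\in a\langle a^2\rangle\cup b\langle a^2\rangle$.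
   Context: $D_n=\langle a,b\mid a^n=b^2=baba=1\rangle$, $C_n=\langle a\rangle$. For a finite group $G$, a generating subset $X\subseteq G$ with $X=X^{ -1}$, $1_G\notin X$, and a cyclic permutation $p$ of $X$, $\mathrm{CM}(G,X,p)$ is the map with underlying Cayley graph $\mathrm{Cay}(G,X)$ and rotation $(g,gx)\mapsto(g,g\,p(x))$; $\mathrm{Aut}(\mathcal M)$ is the group of dart permutations commuting with rotation and dart-reversal, regarded as a permutation group on the vertex set $G$, containing $L(G)=\{L_g\}$, $L_g(h)=gh$; the map is regular if $\mathrm{Aut}(\mathcal M)$ is transitive on darts. A skew-morphism of $G$ is a permutation $\psi$ fixing $1_G$ with a function $\pi:G\to\{1,\dots,r\}$ ($r$ the order of $\psi$) such that $\psi(gh)=\psi(g)\psi^{\pi(g)}(h)$; a Cayley map is regular iff some skew-morphism $\psi$ agrees with $p$ on $X$, and this unique $\psi$ (of order $|X|$) and its power function $\pi$ are the associated ones. $\mathrm{Ker}(\pi)=\{g:\pi(g)=1\}$. The core of a subgroup $A$ in a group $B$ is the largest normal subgroup of $B$ contained in $A$. -}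

module Defs where

open import Data.Nat using (ℕ; zero; suc; _+_; _*_; _∸_; _≤_; _<_; NonZero; _%_)
open import Data.Nat.Properties using (m*n≢0)
open import Data.Nat.DivMod using (_mod_)
open import Data.Nat.Divisibility using (_∣_)
open import Data.Fin using (Fin; toℕ)
open import Data.Bool using (Bool; true; false; not; if_then_else_; _xor_)
open import Data.Product using (Σ; _×_; _,_; proj₁; proj₂; ∃)
open import Data.Sum using (_⊎_)
open import Relation.Binary.PropositionalEquality using (_≡_)
open import Relation.Nullary using (¬_)
open import Level using (Level; suc) renaming (zero to lzero)

_^[_] : {A : Set} → (A → A) → ℕ → A → A
(f ^[ zero ]) x = x
(f ^[ suc k ]) x = f ((f ^[ k ]) x)

module Dn (m : ℕ) .{{_ : NonZero m}} where

  n : ℕ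
  n = 2 * m

  instance
    nz : NonZero n
    nz = m*n≢0 2 m

  _⊕_ : Fin n → Fin n → Fin n
  i ⊕ j = (toℕ i + toℕ j) mod n

  ⊖_ : Fin n → Fin n
  ⊖ i = (n ∸ toℕ i) mod n

  z0 z1 : Fin n
  z0 = 0 mod n
  z1 = 1 mod n

  -- parity of an exponent (well defined mod n since n is even)
  isEven : Fin n → Bool
  isEven j = (toℕ j % 2) Data.Nat.≡ᵇ 0

  -- The element a^j b^s of D_n is represented as (j , s), s = true meaning b^1.
  G : Set
  G = Fin n × Bool

  a^ : Fin n → G
  a^ j = (j , false)

  a^_b : Fin n → G
  a^ j b = (j , true)

  e : G
  e = a^ z0

  -- (a^i b^s)(a^j b^t) = a^(i ± j) b^(s+t), using b a^j = a^(-j) b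
  _·_ : G → G → G
  (i , s) · (j , t) = (i ⊕ (if s then ⊖ j else j)) , (s xor t)

  _⁻¹ : G → G
  (i , false) ⁻¹ = (⊖ i , false)
  (i , true) ⁻¹ = (i , true)

  -- The connection set X = a⟨a²⟩ ∪ b⟨a²⟩ = {a^j : j odd} ∪ {a^j b : j even}.
  InX : G → Set
  InX (j , false) = isEven j ≡ false
  InX (j , true)  = isEven j ≡ true

  -- Enumeration of X in the cyclic order of p = (b, a, a²b, a³, ..., a^(n-2)b, a^(n-1)):
  -- x k = p^k(b), i.e. x k = a^k b for k even and x k = a^k for k odd.
  x : Fin n → G
  x k = (k , isEven k)

  -- position in the cycle of an element of X (inverse of x on X)
  idx : G → Fin n
  idx (j , _) = j

  pos-p : Fin n → Fin n
  pos-p k = k ⊕ z1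

  -- The Cayley map M = CM(D_n, X, p)
  -- dart (g , k) is the arc from g to g · x k
  Dart : Set
  Dart = G × Fin n

  R : Dart → Dart
  R (g , k) = (g , pos-p k)

  -- dart-reversal (g, g x) ↦ (g x, g)  (the arc from g x along x⁻¹)
  Rev : Dart → Dart
  Rev (g , k) = (g · x k , idx ((x k) ⁻¹))

  record Auto : Set where
    field
      f     : Dart → Dart
      f⁻    : Dart → Dart
      left  : ∀ d → f⁻ (f d) ≡ d
      right : ∀ d → f (f⁻ d) ≡ d
      comR  : ∀ d → f (R d) ≡ R (f d)
      comRev : ∀ d → f (Rev d) ≡ Rev (f d)
  open Auto public

  Regular : Set
  Regular = ∀ (d d′ : Dart) → Σ Auto (λ φ → f φ d ≡ d′)

  IsL : G → Auto → Set
  IsL g σ = ∀ (d : Dart) → f σ d ≡ (g · proj₁ d , proj₂ d)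

  -- subgroups / normal subgroups of Aut(M), given as predicates (closed under ≈ pointwise)
  record IsNormalSubgroup (S : Auto → Set) : Set where
    field
      has-id  : ∀ χ → (∀ d → f χ d ≡ d) → S χ
      has-∘   : ∀ φ ψ χ → S φ → S ψ → (∀ d → f χ d ≡ f φ (f ψ d)) → S χ
      has-inv : ∀ φ χ → S φ → (∀ d → f χ d ≡ f⁻ φ d) → S χ
      normal  : ∀ φ σ χ → S σ → (∀ d → f χ d ≡ f φ (f σ (f⁻ φ d))) → S χ

  InLCn : (Auto → Set) → Set
  InLCn S = ∀ σ → S σ → Σ (Fin n) (λ c → IsL (a^ c) σ)

  -- L(N) for N ⊆ C_n (N given by a predicate on exponents c, meaning a^c ∈ N)
  LOf : (Fin n → Set) → Auto → Set
  LOf N σ = Σ (Fin n) (λ c → N c × IsL (a^ c) σ)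

  IsCore : (Fin n → Set) → Set₁
  IsCore N = IsNormalSubgroup (LOf N)
           × (∀ (S : Auto → Set) → IsNormalSubgroup S → InLCn S → ∀ σ → S σ → LOf N σ)

  IsOrder : (G → G) → ℕ → Set
  IsOrder ψ r = 1 ≤ r × (∀ g → (ψ ^[ r ]) g ≡ g)
              × (∀ k → 1 ≤ k → k < r → ¬ (∀ g → (ψ ^[ k ]) g ≡ g))

  record IsSkew (ψ : G → G) (π : G → ℕ) : Set where
    field
      ψ⁻      : G → G
      invl    : ∀ g → ψ⁻ (ψ g) ≡ g
      invr    : ∀ g → ψ (ψ⁻ g) ≡ g
      fix1    : ψ e ≡ e
      order   : ℕ
      isOrder : IsOrder ψ order
      π-range : ∀ g → 1 ≤ π g × π g ≤ order
      skew    : ∀ g h → ψ (g · h) ≡ ψ g · (ψ ^[ π g ]) h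

  IsAssociated : (G → G) → Set
  IsAssociated ψ = Σ (G → ℕ) (λ π → IsSkew ψ π) × (∀ k → ψ (x k) ≡ x (pos-p k))

  ψ₀ : G → G
  ψ₀ (j , false) = if isEven j then a^ (⊖ j) else a^ (j ⊕ z1) b
  ψ₀ (j , true)  = if isEven j then a^ (j ⊕ z1) else a^ (⊖ j) b

  -- Ker(π) ≅ Z₂², Z₂² = Bool × Bool under componentwise xor
  KerIsoZ2² : (G → ℕ) → Set
  KerIsoZ2² π = Σ (Bool × Bool → G) λ φ →
      (∀ u v → φ u ≡ φ v → u ≡ v)
    × (∀ u → π (φ u) ≡ 1)
    × (∀ g → π g ≡ 1 → Σ (Bool × Bool) (λ u → φ u ≡ g))
    × (∀ u v → φ ((proj₁ u xor proj₁ v) , (proj₂ u xor proj₂ v)) ≡ φ u · φ v)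

-- The element a^j b^s lies in X exactly when j ≡ s (mod 2). The map ψ₀ moves X one step along
-- the cycle p and acts on the complement of X as conjugation by b, an involution. The power
-- function π₀(a^j b^s) = ±(2j + 1), with sign − for s = 1, is always odd, so ψ₀^π₀(g) is again a
-- shift on X and equals ψ₀ off X; after splitting by membership of g and h in X, the skew identity
-- ψ₀(gh) = ψ₀(g) ψ₀^π₀(g)(h) becomes a ring identity in ℤ/n. The skew-morphism induces an
-- automorphism Φ of the map fixing the vertex 1 and rotating the darts there, so together with the
-- left translations Aut(M) is dart-transitive. Conjugating a translation L(a^c) by Φ gives a
-- translation only if ψ₀(a^c) ∈ ⟨a⟩ and π₀(a^c) = 1, i.e. c is even and 2c = 0; hence the core lies
-- in {1, a^m}, with a^m only for m even. Conversely, for m even L(a^m) is the walk "half a turn,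
-- along the edge, half a turn, along the edge", which every automorphism respects. Finally the skew
-- identity at h = b determines any power function modulo the order n of ψ₀, which gives its kernel,
-- its values and its residues mod 4.
module Submission where

open import Algebra.Bundles using (CommutativeRing; Group)
import Algebra.Properties.Group as GroupProperties
import Algebra.Properties.Ring as RingProperties
open import Algebra.Solver.Ring.AlmostCommutativeRing
  using (_-Raw-AlmostCommutative⟶_; fromCommutativeRing)
open import Data.Bool using (Bool; true; false; not; _xor_; if_then_else_)
open import Data.Bool.Properties using (not-involutive; xor-identityʳ; xor-same)
open import Data.Empty using (⊥-elim)
open import Data.Fin using (Fin; zero; suc; toℕ)
open import Data.Fin.Properties using (toℕ-fromℕ<; toℕ-injective; toℕ<n)
open import Data.Integer as ℤ using (ℤ; +_; -[1+_]; +[1+_])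
import Data.Integer.Properties as ℤ
open import Data.Maybe as Maybe using (Maybe)
open import Data.Nat
  using (ℕ; zero; suc; s≤s; z≤n; _+_; _*_; _∸_; _%_; _≤_; _<_; _≡ᵇ_; NonZero; >-nonZero⁻¹)
open import Data.Nat.Divisibility using (_∣_; divides; n∣m⇒m%n≡0; m%n≡0⇒n∣m)
open import Data.Nat.DivMod
  using ( _mod_; _/_; m%n<n; m<n⇒m%n≡m; n%n≡0; m≡m%n+[m/n]*n; %-distribˡ-+; %-distribˡ-*
        ; [m+n]%n≡m%n; m∣n⇒o%n%m≡o%m)
import Data.Nat.Properties as ℕ
open import Data.Product using (Σ; _×_; _,_; proj₁; proj₂)
open import Data.Sum as Sum using (_⊎_; inj₁; inj₂)
open import Function using (_∘_)
open import Function.Bundles using (_⇔_; mk⇔; Equivalence)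
open import Level using (0ℓ)
open import Relation.Binary.Definitions using (tri<; tri≈; tri>)
open import Relation.Binary.PropositionalEquality
open import Relation.Nullary using (¬_; contradiction)
open import Relation.Nullary.Decidable using (dec⇒maybe)

open import Defs

-- Residues modulo n

module Residues (n : ℕ) .{{_ : NonZero n}} where

  infixl 6 _+ₙ_
  infixl 7 _*ₙ_
  infix  8 -ₙ_

  _+ₙ_ _*ₙ_ : Fin n → Fin n → Fin n
  i +ₙ j = (toℕ i + toℕ j) mod n
  i *ₙ j = (toℕ i * toℕ j) mod n

  -ₙ_ : Fin n → Fin n
  -ₙ i = (n ∸ toℕ i) mod n

  0ₙ 1ₙ : Fin n
  0ₙ = 0 mod n
  1ₙ = 1 mod n

  toℕ-mod : ∀ a → toℕ (a mod n) ≡ a % n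
  toℕ-mod a = toℕ-fromℕ< (m%n<n a n)

  toℕ-mod-< : ∀ {a} → a < n → toℕ (a mod n) ≡ a
  toℕ-mod-< {a} a<n = trans (toℕ-mod a) (m<n⇒m%n≡m a<n)

  mod-cong : ∀ {a b} → a % n ≡ b % n → a mod n ≡ b mod n
  mod-cong {a} {b} eq = toℕ-injective (trans (toℕ-mod a) (trans eq (sym (toℕ-mod b))))

  toℕ-mod-id : ∀ i → toℕ i mod n ≡ i
  toℕ-mod-id i = toℕ-injective (toℕ-mod-< (toℕ<n i))

  mod-homo-+ : ∀ a b → (a + b) mod n ≡ a mod n +ₙ b mod n
  mod-homo-+ a b = mod-cong {b = toℕ (a mod n) + toℕ (b mod n)} (trans (%-distribˡ-+ a b n)
    (sym (cong₂ (λ x y → (x + y) % n) (toℕ-mod a) (toℕ-mod b))))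

  mod-homo-* : ∀ a b → (a * b) mod n ≡ (a mod n) *ₙ (b mod n)
  mod-homo-* a b = mod-cong {b = toℕ (a mod n) * toℕ (b mod n)} (trans (%-distribˡ-* a b n)
    (sym (cong₂ (λ x y → (x * y) % n) (toℕ-mod a) (toℕ-mod b))))

  +ₙ-comm : ∀ i j → i +ₙ j ≡ j +ₙ i
  +ₙ-comm i j = cong (_mod n) (ℕ.+-comm (toℕ i) (toℕ j))

  *ₙ-comm : ∀ i j → i *ₙ j ≡ j *ₙ i
  *ₙ-comm i j = cong (_mod n) (ℕ.*-comm (toℕ i) (toℕ j))

  +ₙ-assoc : ∀ i j k → (i +ₙ j) +ₙ k ≡ i +ₙ (j +ₙ k)
  +ₙ-assoc i j k = begin
    (i +ₙ j) +ₙ k                          ≡⟨ cong (i +ₙ j +ₙ_) (sym (toℕ-mod-id k)) ⟩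
    (toℕ i + toℕ j) mod n +ₙ toℕ k mod n   ≡⟨ sym (mod-homo-+ (toℕ i + toℕ j) (toℕ k)) ⟩
    (toℕ i + toℕ j + toℕ k) mod n          ≡⟨ cong (_mod n) (ℕ.+-assoc (toℕ i) (toℕ j) (toℕ k)) ⟩
    (toℕ i + (toℕ j + toℕ k)) mod n        ≡⟨ mod-homo-+ (toℕ i) (toℕ j + toℕ k) ⟩
    toℕ i mod n +ₙ (j +ₙ k)                ≡⟨ cong (_+ₙ (j +ₙ k)) (toℕ-mod-id i) ⟩
    i +ₙ (j +ₙ k)                          ∎
    where open ≡-Reasoning

  *ₙ-assoc : ∀ i j k → (i *ₙ j) *ₙ k ≡ i *ₙ (j *ₙ k)
  *ₙ-assoc i j k = begin
    (i *ₙ j) *ₙ k                              ≡⟨ cong (i *ₙ j *ₙ_) (sym (toℕ-mod-id k)) ⟩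
    ((toℕ i * toℕ j) mod n) *ₙ (toℕ k mod n)   ≡⟨ sym (mod-homo-* (toℕ i * toℕ j) (toℕ k)) ⟩
    (toℕ i * toℕ j * toℕ k) mod n
      ≡⟨ cong (_mod n) (ℕ.*-assoc (toℕ i) (toℕ j) (toℕ k)) ⟩
    (toℕ i * (toℕ j * toℕ k)) mod n            ≡⟨ mod-homo-* (toℕ i) (toℕ j * toℕ k) ⟩
    (toℕ i mod n) *ₙ (j *ₙ k)                  ≡⟨ cong (_*ₙ (j *ₙ k)) (toℕ-mod-id i) ⟩
    i *ₙ (j *ₙ k)                              ∎
    where open ≡-Reasoning

  +ₙ-identityˡ : ∀ i → 0ₙ +ₙ i ≡ i
  +ₙ-identityˡ i = begin
    0ₙ +ₙ i               ≡⟨ cong (0ₙ +ₙ_) (sym (toℕ-mod-id i)) ⟩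
    0ₙ +ₙ toℕ i mod n     ≡⟨ sym (mod-homo-+ 0 (toℕ i)) ⟩
    toℕ i mod n           ≡⟨ toℕ-mod-id i ⟩
    i                     ∎
    where open ≡-Reasoning

  *ₙ-identityˡ : ∀ i → 1ₙ *ₙ i ≡ i
  *ₙ-identityˡ i = begin
    1ₙ *ₙ i               ≡⟨ cong (1ₙ *ₙ_) (sym (toℕ-mod-id i)) ⟩
    1ₙ *ₙ (toℕ i mod n)   ≡⟨ sym (mod-homo-* 1 (toℕ i)) ⟩
    (1 * toℕ i) mod n     ≡⟨ cong (_mod n) (ℕ.*-identityˡ (toℕ i)) ⟩
    toℕ i mod n           ≡⟨ toℕ-mod-id i ⟩
    i                     ∎
    where open ≡-Reasoning

  -ₙ-inverseˡ : ∀ i → -ₙ i +ₙ i ≡ 0ₙ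
  -ₙ-inverseˡ i = begin
    -ₙ i +ₙ i                   ≡⟨ cong (-ₙ i +ₙ_) (sym (toℕ-mod-id i)) ⟩
    -ₙ i +ₙ toℕ i mod n         ≡⟨ sym (mod-homo-+ (n ∸ toℕ i) (toℕ i)) ⟩
    (n ∸ toℕ i + toℕ i) mod n   ≡⟨ cong (_mod n) (ℕ.m∸n+n≡m (ℕ.<⇒≤ (toℕ<n i))) ⟩
    n mod n                     ≡⟨ mod-cong ([m+n]%n≡m%n 0 n) ⟩
    0ₙ                          ∎
    where open ≡-Reasoning

  *ₙ-distribʳ-+ₙ : ∀ i j k → (j +ₙ k) *ₙ i ≡ j *ₙ i +ₙ k *ₙ i
  *ₙ-distribʳ-+ₙ i j k = begin
    (j +ₙ k) *ₙ i                                ≡⟨ cong ((j +ₙ k) *ₙ_) (sym (toℕ-mod-id i)) ⟩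
    ((toℕ j + toℕ k) mod n) *ₙ (toℕ i mod n)     ≡⟨ sym (mod-homo-* (toℕ j + toℕ k) (toℕ i)) ⟩
    ((toℕ j + toℕ k) * toℕ i) mod n
      ≡⟨ cong (_mod n) (ℕ.*-distribʳ-+ (toℕ i) (toℕ j) (toℕ k)) ⟩
    (toℕ j * toℕ i + toℕ k * toℕ i) mod n        ≡⟨ mod-homo-+ (toℕ j * toℕ i) (toℕ k * toℕ i) ⟩
    j *ₙ i +ₙ k *ₙ i                             ∎
    where open ≡-Reasoning

  +-*-commutativeRing : CommutativeRing 0ℓ 0ℓ
  +-*-commutativeRing = record
    { Carrier = Fin n ; _≈_ = _≡_ ; _+_ = _+ₙ_ ; _*_ = _*ₙ_ ; -_ = -ₙ_ ; 0# = 0ₙ ; 1# = 1ₙ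
    ; isCommutativeRing = record
      { isRing = record
        { +-isAbelianGroup = record
          { isGroup = record
            { isMonoid = record
              { isSemigroup = record
                { isMagma = record { isEquivalence = isEquivalence ; ∙-cong = cong₂ _+ₙ_ }
                ; assoc = +ₙ-assoc }
              ; identity = +ₙ-identityˡ , λ i → trans (+ₙ-comm i 0ₙ) (+ₙ-identityˡ i) }
            ; inverse = -ₙ-inverseˡ , λ i → trans (+ₙ-comm i (-ₙ i)) (-ₙ-inverseˡ i)
            ; ⁻¹-cong = cong -ₙ_ }
          ; comm = +ₙ-comm }
        ; *-cong = cong₂ _*ₙ_
        ; *-assoc = *ₙ-assoc
        ; *-identity = *ₙ-identityˡ , λ i → trans (*ₙ-comm i 1ₙ) (*ₙ-identityˡ i)
        ; distrib = (λ i j k → trans (*ₙ-comm i (j +ₙ k)) (trans (*ₙ-distribʳ-+ₙ i j k)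
                                 (cong₂ _+ₙ_ (*ₙ-comm j i) (*ₙ-comm k i))))
                  , *ₙ-distribʳ-+ₙ }
      ; *-comm = *ₙ-comm } }

  open CommutativeRing +-*-commutativeRing using (+-identityˡ; +-identityʳ; +-assoc; +-comm; -‿inverseʳ)
  open RingProperties (CommutativeRing.ring +-*-commutativeRing)
    using (-0#≈0#; -‿involutive; -‿distribˡ-*; -‿distribʳ-*; -‿+-comm)

  fromℤ : ℤ → Fin n
  fromℤ (+ a)    = a mod n
  fromℤ -[1+ a ] = -ₙ (suc a mod n)

  fromℤ-neg : ∀ x → fromℤ (ℤ.- x) ≡ -ₙ fromℤ x
  fromℤ-neg (+ zero) = sym -0#≈0#
  fromℤ-neg +[1+ a ] = refl
  fromℤ-neg -[1+ a ] = sym (-‿involutive (suc a mod n))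

  fromℤ-⊖ : ∀ a b → fromℤ (a ℤ.⊖ b) ≡ a mod n +ₙ -ₙ (b mod n)
  fromℤ-⊖ a       zero    = sym (trans (cong (a mod n +ₙ_) -0#≈0#) (+-identityʳ (a mod n)))
  fromℤ-⊖ zero    (suc b) = sym (+-identityˡ (-ₙ (suc b mod n)))
  fromℤ-⊖ (suc a) (suc b) = begin
    fromℤ (suc a ℤ.⊖ suc b)           ≡⟨ cong fromℤ (ℤ.[1+m]⊖[1+n]≡m⊖n a b) ⟩
    fromℤ (a ℤ.⊖ b)                   ≡⟨ fromℤ-⊖ a b ⟩
    x +ₙ -ₙ y                         ≡⟨ cong (x +ₙ_) (sym (+-identityˡ (-ₙ y))) ⟩
    x +ₙ (0ₙ +ₙ -ₙ y)                 ≡⟨ cong (λ z → x +ₙ (z +ₙ -ₙ y)) (sym (-‿inverseʳ 1ₙ)) ⟩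
    x +ₙ ((1ₙ +ₙ -ₙ 1ₙ) +ₙ -ₙ y)      ≡⟨ cong (x +ₙ_) (+-assoc 1ₙ (-ₙ 1ₙ) (-ₙ y)) ⟩
    x +ₙ (1ₙ +ₙ (-ₙ 1ₙ +ₙ -ₙ y))      ≡⟨ sym (+-assoc x 1ₙ _) ⟩
    (x +ₙ 1ₙ) +ₙ (-ₙ 1ₙ +ₙ -ₙ y)      ≡⟨ cong₂ _+ₙ_ (+-comm x 1ₙ) (-‿+-comm 1ₙ y) ⟩
    (1ₙ +ₙ x) +ₙ -ₙ (1ₙ +ₙ y)
      ≡⟨ sym (cong₂ (λ u v → u +ₙ -ₙ v) (mod-homo-+ 1 a) (mod-homo-+ 1 b)) ⟩
    suc a mod n +ₙ -ₙ (suc b mod n)   ∎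
    where
    open ≡-Reasoning
    x = a mod n
    y = b mod n

  fromℤ-+ : ∀ x y → fromℤ (x ℤ.+ y) ≡ fromℤ x +ₙ fromℤ y
  fromℤ-+ (+ a)    (+ b)    = mod-homo-+ a b
  fromℤ-+ (+ a)    -[1+ b ] = fromℤ-⊖ a (suc b)
  fromℤ-+ -[1+ a ] (+ b)    = trans (fromℤ-⊖ b (suc a)) (+-comm (b mod n) _)
  fromℤ-+ -[1+ a ] -[1+ b ] = begin
    -ₙ (suc (suc (a + b)) mod n)           ≡⟨ cong (λ z → -ₙ (z mod n)) (sym (ℕ.+-suc (suc a) b)) ⟩
    -ₙ ((suc a + suc b) mod n)             ≡⟨ cong -ₙ_ (mod-homo-+ (suc a) (suc b)) ⟩
    -ₙ (suc a mod n +ₙ suc b mod n)        ≡⟨ sym (-‿+-comm (suc a mod n) (suc b mod n)) ⟩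
    -ₙ (suc a mod n) +ₙ -ₙ (suc b mod n)   ∎
    where open ≡-Reasoning

  fromℤ-pos-* : ∀ a y → fromℤ (+ a ℤ.* y) ≡ (a mod n) *ₙ fromℤ y
  fromℤ-pos-* a (+ b)    = trans (cong fromℤ (sym (ℤ.pos-* a b))) (mod-homo-* a b)
  fromℤ-pos-* a -[1+ b ] = begin
    fromℤ (+ a ℤ.* ℤ.- + suc b)       ≡⟨ cong fromℤ (sym (ℤ.neg-distribʳ-* (+ a) (+ suc b))) ⟩
    fromℤ (ℤ.- (+ a ℤ.* + suc b))     ≡⟨ fromℤ-neg (+ a ℤ.* + suc b) ⟩
    -ₙ fromℤ (+ a ℤ.* + suc b)        ≡⟨ cong -ₙ_ (fromℤ-pos-* a (+ suc b)) ⟩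
    -ₙ ((a mod n) *ₙ (suc b mod n))   ≡⟨ -‿distribʳ-* (a mod n) (suc b mod n) ⟩
    (a mod n) *ₙ -ₙ (suc b mod n)     ∎
    where open ≡-Reasoning

  fromℤ-* : ∀ x y → fromℤ (x ℤ.* y) ≡ fromℤ x *ₙ fromℤ y
  fromℤ-* (+ a)    y = fromℤ-pos-* a y
  fromℤ-* -[1+ a ] y = begin
    fromℤ (ℤ.- + suc a ℤ.* y)         ≡⟨ cong fromℤ (sym (ℤ.neg-distribˡ-* (+ suc a) y)) ⟩
    fromℤ (ℤ.- (+ suc a ℤ.* y))       ≡⟨ fromℤ-neg (+ suc a ℤ.* y) ⟩
    -ₙ fromℤ (+ suc a ℤ.* y)          ≡⟨ cong -ₙ_ (fromℤ-pos-* (suc a) y) ⟩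
    -ₙ ((suc a mod n) *ₙ fromℤ y)     ≡⟨ -‿distribˡ-* (suc a mod n) (fromℤ y) ⟩
    -ₙ (suc a mod n) *ₙ fromℤ y       ∎
    where open ≡-Reasoning

  fromℤ-homomorphism : ℤ.+-*-rawRing -Raw-AlmostCommutative⟶ fromCommutativeRing +-*-commutativeRing
  fromℤ-homomorphism = record
    { ⟦_⟧ = fromℤ ; +-homo = fromℤ-+ ; *-homo = fromℤ-* ; -‿homo = fromℤ-neg
    ; 0-homo = refl ; 1-homo = refl }

  fromℤ-≟ : ∀ x y → Maybe (fromℤ x ≡ fromℤ y)
  fromℤ-≟ x y = Maybe.map (cong fromℤ) (dec⇒maybe (x ℤ.≟ y))

  -- Integer coefficients: normal forms are then compared by computing on closed integers,
  -- whereas residues modulo a variable n do not compute.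
  open import Algebra.Solver.Ring ℤ.+-*-rawRing (fromCommutativeRing +-*-commutativeRing)
    fromℤ-homomorphism fromℤ-≟ public
    using (Polynomial; solve; _:=_; _:+_; :-_; _:-_; con)

  :0 :1 : ∀ {k} → Polynomial k
  :0 = con (+ 0)
  :1 = con (+ 1)

module Reduction (n : ℕ) .{{_ : NonZero n}} (d : ℕ) .{{_ : NonZero d}} (d∣n : d ∣ n) where
  private
    module N = Residues n
    module D = Residues d
  open RingProperties (CommutativeRing.ring D.+-*-commutativeRing) using (+-inverseˡ-unique)

  reduce : Fin n → Fin d
  reduce i = toℕ i mod d

  reduce-mod : ∀ a → reduce (a mod n) ≡ a mod d
  reduce-mod a = D.mod-cong {b = a} (trans (cong (_% d) (N.toℕ-mod a)) (m∣n⇒o%n%m≡o%m d n a d∣n))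

  reduce-+ : ∀ i j → reduce (i N.+ₙ j) ≡ reduce i D.+ₙ reduce j
  reduce-+ i j = trans (reduce-mod (toℕ i + toℕ j)) (D.mod-homo-+ (toℕ i) (toℕ j))

  reduce-neg : ∀ i → reduce (N.-ₙ i) ≡ D.-ₙ reduce i
  reduce-neg i = +-inverseˡ-unique (reduce (N.-ₙ i)) (reduce i) (begin
    reduce (N.-ₙ i) D.+ₙ reduce i   ≡⟨ sym (reduce-+ (N.-ₙ i) i) ⟩
    reduce (N.-ₙ i N.+ₙ i)          ≡⟨ cong reduce (N.-ₙ-inverseˡ i) ⟩
    reduce N.0ₙ                     ≡⟨ reduce-mod 0 ⟩
    D.0ₙ                            ∎)
    where open ≡-Reasoning

^[]-semiconj : ∀ {A B : Set} {f : B → B} {g : A → A} (h : A → B) →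
               (∀ a → f (h a) ≡ h (g a)) → ∀ t a → (f ^[ t ]) (h a) ≡ h ((g ^[ t ]) a)
^[]-semiconj h comm zero    a = refl
^[]-semiconj {f = f} {g} h comm (suc t) a =
  trans (cong f (^[]-semiconj h comm t a)) (comm ((g ^[ t ]) a))

^[]-involution : ∀ {A : Set} (f : A → A) {x} → f (f x) ≡ x → ∀ t → (f ^[ t ]) x ≡ (f ^[ t % 2 ]) x
^[]-involution f     inv zero          = refl
^[]-involution f     inv (suc zero)    = refl
^[]-involution f {x} inv (suc (suc t)) = begin
  f (f ((f ^[ t ]) x))         ≡⟨ cong (λ y → f (f y)) (^[]-involution f inv t) ⟩
  f (f ((f ^[ t % 2 ]) x))     ≡⟨ cong f (sym (^[]-semiconj f (λ _ → refl) (t % 2) x)) ⟩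
  f ((f ^[ t % 2 ]) (f x))     ≡⟨ sym (^[]-semiconj f (λ _ → refl) (t % 2) (f x)) ⟩
  (f ^[ t % 2 ]) (f (f x))     ≡⟨ cong (f ^[ t % 2 ]) inv ⟩
  (f ^[ t % 2 ]) x             ∎
  where open ≡-Reasoning

%-injective : ∀ {n a b} .{{_ : NonZero n}} → a ≤ n → 0 < b → b < n → a % n ≡ b % n → a ≡ b
%-injective {n} {a} {b} a≤n 0<b b<n a≡b-mod-n with ℕ.m≤n⇒m<n∨m≡n a≤n
... | inj₁ a<n  = trans (sym (m<n⇒m%n≡m a<n)) (trans a≡b-mod-n (m<n⇒m%n≡m b<n))
... | inj₂ refl = contradiction (trans (sym (n%n≡0 n)) (trans a≡b-mod-n (m<n⇒m%n≡m b<n))) (ℕ.<⇒≢ 0<b)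

pigeonhole : ∀ {A : Set} {a b x y z : A} → x ≡ a ⊎ x ≡ b → y ≡ a ⊎ y ≡ b → z ≡ a ⊎ z ≡ b →
             x ≡ y ⊎ x ≡ z ⊎ y ≡ z
pigeonhole (inj₁ x≡a) (inj₁ y≡a) _          = inj₁ (trans x≡a (sym y≡a))
pigeonhole (inj₂ x≡b) (inj₂ y≡b) _          = inj₁ (trans x≡b (sym y≡b))
pigeonhole (inj₁ x≡a) (inj₂ _)   (inj₁ z≡a) = inj₂ (inj₁ (trans x≡a (sym z≡a)))
pigeonhole (inj₂ x≡b) (inj₁ _)   (inj₂ z≡b) = inj₂ (inj₁ (trans x≡b (sym z≡b)))
pigeonhole (inj₁ _)   (inj₂ y≡b) (inj₂ z≡b) = inj₂ (inj₂ (trans y≡b (sym z≡b)))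
pigeonhole (inj₂ _)   (inj₁ y≡a) (inj₁ z≡a) = inj₂ (inj₂ (trans y≡a (sym z≡a)))

module Dihedral (m : ℕ) .{{_ : NonZero m}} where
  open Dn m
  open Residues n
  private module ℤ₂ = Residues 2

  n≡m+m : n ≡ m + m
  n≡m+m = cong (λ k → m + k) (ℕ.+-identityʳ m)

  m<n : m < n
  m<n = subst (m <_) (sym n≡m+m) (ℕ.m<m+n m (>-nonZero⁻¹ m))

  1<n : 1 < n
  1<n = ℕ.≤-trans (s≤s (>-nonZero⁻¹ m)) m<n

  2∣n : 2 ∣ n
  2∣n = divides m (ℕ.*-comm 2 m)

  private module Mod₂ = Reduction n 2 2∣n

  toℕ-z0 : toℕ z0 ≡ 0
  toℕ-z0 = toℕ-mod-< (ℕ.<⇒≤ 1<n)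

  toℕ-z1 : toℕ z1 ≡ 1
  toℕ-z1 = toℕ-mod-< 1<n

  m' : Fin n
  m' = m mod n

  toℕ-m' : toℕ m' ≡ m
  toℕ-m' = toℕ-mod-< m<n

  m'⊕m' : m' ⊕ m' ≡ z0
  m'⊕m' = trans (sym (mod-homo-+ m m)) (mod-cong (trans (cong (_% n) (sym n≡m+m)) ([m+n]%n≡m%n 0 n)))

  ⊖m'≡m' : ⊖ m' ≡ m'
  ⊖m'≡m' = sym (+-inverseʳ-unique m' m' m'⊕m')
    where open RingProperties (CommutativeRing.ring +-*-commutativeRing) using (+-inverseʳ-unique)

  z0≢m' : z0 ≢ m'
  z0≢m' eq = ℕ.<⇒≢ (>-nonZero⁻¹ m) (trans (sym toℕ-z0) (trans (cong toℕ eq) toℕ-m'))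

  ⊖-involutive : ∀ j → ⊖ (⊖ j) ≡ j
  ⊖-involutive = solve 1 (λ j → :- (:- j) := j) refl

  +1-1 : ∀ j → (j ⊕ z1) ⊕ (⊖ z1) ≡ j
  +1-1 = solve 1 (λ j → (j :+ :1) :- :1 := j) refl

  even₂ : Fin 2 → Bool
  even₂ a = toℕ a ≡ᵇ 0

  isEven-reduce : ∀ j → isEven j ≡ even₂ (Mod₂.reduce j)
  isEven-reduce j = cong (_≡ᵇ 0) (sym (ℤ₂.toℕ-mod (toℕ j)))

  isEven-⊕ : ∀ i j → isEven (i ⊕ j) ≡ not (isEven i xor isEven j)
  isEven-⊕ i j = begin
    isEven (i ⊕ j)                      ≡⟨ isEven-reduce (i ⊕ j) ⟩
    even₂ (r (i ⊕ j))                   ≡⟨ cong even₂ (Mod₂.reduce-+ i j) ⟩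
    even₂ (r i ℤ₂.+ₙ r j)               ≡⟨ even₂-+ (r i) (r j) ⟩
    not (even₂ (r i) xor even₂ (r j))
      ≡⟨ sym (cong₂ (λ a b → not (a xor b)) (isEven-reduce i) (isEven-reduce j)) ⟩
    not (isEven i xor isEven j)         ∎
    where
    open ≡-Reasoning
    r = Mod₂.reduce
    even₂-+ : ∀ a b → even₂ (a ℤ₂.+ₙ b) ≡ not (even₂ a xor even₂ b)
    even₂-+ zero       zero       = refl
    even₂-+ zero       (suc zero) = refl
    even₂-+ (suc zero) zero       = refl
    even₂-+ (suc zero) (suc zero) = refl

  isEven-⊖ : ∀ i → isEven (⊖ i) ≡ isEven i
  isEven-⊖ i = begin
    isEven (⊖ i)          ≡⟨ isEven-reduce (⊖ i) ⟩
    even₂ (r (⊖ i))       ≡⟨ cong even₂ (Mod₂.reduce-neg i) ⟩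
    even₂ (ℤ₂.-ₙ r i)     ≡⟨ even₂-neg (r i) ⟩
    even₂ (r i)           ≡⟨ sym (isEven-reduce i) ⟩
    isEven i              ∎
    where
    open ≡-Reasoning
    r = Mod₂.reduce
    even₂-neg : ∀ a → even₂ (ℤ₂.-ₙ a) ≡ even₂ a
    even₂-neg zero       = refl
    even₂-neg (suc zero) = refl

  ⊕-parity : ∀ i j {a b} → isEven i ≡ a → isEven j ≡ b → isEven (i ⊕ j) ≡ not (a xor b)
  ⊕-parity i j ei ej = trans (isEven-⊕ i j) (cong₂ (λ a b → not (a xor b)) ei ej)

  ⊖-parity : ∀ j {b} → isEven j ≡ b → isEven (⊖ j) ≡ b
  ⊖-parity j ej = trans (isEven-⊖ j) ej

  isEven-z0 : isEven z0 ≡ true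
  isEven-z0 = cong (λ a → a % 2 ≡ᵇ 0) toℕ-z0

  isEven-z1 : isEven z1 ≡ false
  isEven-z1 = cong (λ a → a % 2 ≡ᵇ 0) toℕ-z1

  +1-parity : ∀ j {s} → isEven j ≡ s → isEven (j ⊕ z1) ≡ not s
  +1-parity j {s} ej = trans (⊕-parity j z1 ej isEven-z1) (cong not (xor-identityʳ s))

  -1-parity : ∀ j {s} → isEven j ≡ s → isEven (j ⊕ (⊖ z1)) ≡ not s
  -1-parity j {s} ej = trans (⊕-parity j (⊖ z1) ej (⊖-parity z1 isEven-z1)) (cong not (xor-identityʳ s))

  isEven-m'⇔2∣m : isEven m' ≡ true ⇔ 2 ∣ m
  isEven-m'⇔2∣m = mk⇔
    (λ ev → m%n≡0⇒n∣m m 2 (≡ᵇ0 (m % 2) (trans (cong (λ a → a % 2 ≡ᵇ 0) (sym toℕ-m')) ev)))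
    (λ 2∣m → cong (_≡ᵇ 0) (trans (cong (_% 2) toℕ-m') (n∣m⇒m%n≡0 m 2 2∣m)))
    where
    ≡ᵇ0 : ∀ a → (a ≡ᵇ 0) ≡ true → a ≡ 0
    ≡ᵇ0 zero _ = refl

  odd⇒%2≡1 : ∀ c → isEven c ≡ false → toℕ c % 2 ≡ 1
  odd⇒%2≡1 c odd = remainder (toℕ c % 2) (m%n<n (toℕ c) 2) odd
    where
    remainder : ∀ r → r < 2 → (r ≡ᵇ 0) ≡ false → r ≡ 1
    remainder (suc zero)    _                   _ = refl
    remainder (suc (suc _)) (s≤s (s≤s ()))      _

  odd⇒positive : ∀ c → isEven c ≡ false → 1 ≤ toℕ c
  odd⇒positive c odd with toℕ c | odd⇒%2≡1 c odd
  ... | suc _ | _ = s≤s z≤n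

  -- The dihedral group Dₙ

  ·-assoc : ∀ g h k → (g · h) · k ≡ g · (h · k)
  ·-assoc (i , false) (j , false) (l , w) =
    cong (_, w) (solve 3 (λ i j l → (i :+ j) :+ l := i :+ (j :+ l)) refl i j l)
  ·-assoc (i , false) (j , true)  (l , w) =
    cong (_, not w) (solve 3 (λ i j l → (i :+ j) :- l := i :+ (j :- l)) refl i j l)
  ·-assoc (i , true)  (j , false) (l , w) =
    cong (_, not w) (solve 3 (λ i j l → (i :- j) :- l := i :- (j :+ l)) refl i j l)
  ·-assoc (i , true)  (j , true)  (l , w) =
    cong₂ _,_ (solve 3 (λ i j l → (i :- j) :+ l := i :- (j :- l)) refl i j l) (sym (not-involutive w))

  ·-identityˡ : ∀ g → e · g ≡ g
  ·-identityˡ (j , t) = cong (_, t) (solve 1 (λ j → :0 :+ j := j) refl j)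

  ·-identityʳ : ∀ g → g · e ≡ g
  ·-identityʳ (j , false) = cong (_, false) (solve 1 (λ j → j :+ :0 := j) refl j)
  ·-identityʳ (j , true)  = cong (_, true) (solve 1 (λ j → j :- :0 := j) refl j)

  ·-inverseˡ : ∀ g → (g ⁻¹) · g ≡ e
  ·-inverseˡ (j , false) = cong (_, false) (solve 1 (λ j → :- j :+ j := :0) refl j)
  ·-inverseˡ (j , true)  = cong (_, false) (solve 1 (λ j → j :- j := :0) refl j)

  ·-inverseʳ : ∀ g → g · (g ⁻¹) ≡ e
  ·-inverseʳ (j , false) = cong (_, false) (solve 1 (λ j → j :- j := :0) refl j)
  ·-inverseʳ (j , true)  = cong (_, false) (solve 1 (λ j → j :- j := :0) refl j)

  Dₙ : Group 0ℓ 0ℓ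
  Dₙ = record
    { Carrier = G ; _≈_ = _≡_ ; _∙_ = _·_ ; ε = e ; _⁻¹ = _⁻¹
    ; isGroup = record
      { isMonoid = record
        { isSemigroup = record
          { isMagma = record { isEquivalence = isEquivalence ; ∙-cong = cong₂ _·_ }
          ; assoc = ·-assoc }
        ; identity = ·-identityˡ , ·-identityʳ }
      ; inverse = ·-inverseˡ , ·-inverseʳ
      ; ⁻¹-cong = cong _⁻¹ } }

  open GroupProperties Dₙ using (\\-leftDividesˡ; \\-leftDividesʳ; ∙-cancelˡ; ∙-cancelʳ)

  m'-central : ∀ g → g · a^ m' ≡ a^ m' · g
  m'-central (j , false) = cong (_, false) (solve 2 (λ j u → j :+ u := u :+ j) refl j m')
  m'-central (j , true)  =
    cong (_, true) (trans (cong (j ⊕_) ⊖m'≡m') (solve 2 (λ j u → j :+ u := u :+ j) refl j m'))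

  -- The skew-morphism ψ₀

  data Membership (j : Fin n) (s : Bool) : Set where
    member    : isEven j ≡ s     → Membership j s
    nonmember : isEven j ≡ not s → Membership j s

  membership : ∀ j s → Membership j s
  membership j s = classify (isEven j) s refl
    where
    classify : ∀ a s → isEven j ≡ a → Membership j s
    classify true  true  ej = member ej
    classify true  false ej = nonmember ej
    classify false false ej = member ej
    classify false true  ej = nonmember ej

  ψ₀-member : ∀ j s → isEven j ≡ s → ψ₀ (j , s) ≡ (j ⊕ z1 , not s)
  ψ₀-member j false ej = cong (λ c → if c then a^ (⊖ j) else a^ (j ⊕ z1) b) ej
  ψ₀-member j true  ej = cong (λ c → if c then a^ (j ⊕ z1) else a^ (⊖ j) b) ej

  ψ₀-nonmember : ∀ j s → isEven j ≡ not s → ψ₀ (j , s) ≡ (⊖ j , s)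
  ψ₀-nonmember j false ej = cong (λ c → if c then a^ (⊖ j) else a^ (j ⊕ z1) b) ej
  ψ₀-nonmember j true  ej = cong (λ c → if c then a^ (j ⊕ z1) else a^ (⊖ j) b) ej

  ψ₀⁻¹ : G → G
  ψ₀⁻¹ (j , false) = if isEven j then a^ (⊖ j) else a^ (j ⊕ (⊖ z1)) b
  ψ₀⁻¹ (j , true)  = if isEven j then a^ (j ⊕ (⊖ z1)) else a^ (⊖ j) b

  ψ₀⁻¹-member : ∀ j s → isEven j ≡ s → ψ₀⁻¹ (j , s) ≡ (j ⊕ (⊖ z1) , not s)
  ψ₀⁻¹-member j false ej = cong (λ c → if c then a^ (⊖ j) else a^ (j ⊕ (⊖ z1)) b) ej
  ψ₀⁻¹-member j true  ej = cong (λ c → if c then a^ (j ⊕ (⊖ z1)) else a^ (⊖ j) b) ej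

  ψ₀⁻¹-nonmember : ∀ j s → isEven j ≡ not s → ψ₀⁻¹ (j , s) ≡ (⊖ j , s)
  ψ₀⁻¹-nonmember j false ej = cong (λ c → if c then a^ (⊖ j) else a^ (j ⊕ (⊖ z1)) b) ej
  ψ₀⁻¹-nonmember j true  ej = cong (λ c → if c then a^ (j ⊕ (⊖ z1)) else a^ (⊖ j) b) ej

  ψ₀⁻¹-ψ₀ : ∀ g → ψ₀⁻¹ (ψ₀ g) ≡ g
  ψ₀⁻¹-ψ₀ (j , s) with membership j s
  ... | member ej = begin
    ψ₀⁻¹ (ψ₀ (j , s))                   ≡⟨ cong ψ₀⁻¹ (ψ₀-member j s ej) ⟩
    ψ₀⁻¹ (j ⊕ z1 , not s)               ≡⟨ ψ₀⁻¹-member (j ⊕ z1) (not s) (+1-parity j ej) ⟩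
    ((j ⊕ z1) ⊕ (⊖ z1) , not (not s))   ≡⟨ cong₂ _,_ (+1-1 j) (not-involutive s) ⟩
    (j , s)                             ∎
    where open ≡-Reasoning
  ... | nonmember ej = begin
    ψ₀⁻¹ (ψ₀ (j , s))                   ≡⟨ cong ψ₀⁻¹ (ψ₀-nonmember j s ej) ⟩
    ψ₀⁻¹ (⊖ j , s)                      ≡⟨ ψ₀⁻¹-nonmember (⊖ j) s (⊖-parity j ej) ⟩
    (⊖ (⊖ j) , s)                       ≡⟨ cong (_, s) (⊖-involutive j) ⟩
    (j , s)                             ∎
    where open ≡-Reasoning

  ψ₀-ψ₀⁻¹ : ∀ g → ψ₀ (ψ₀⁻¹ g) ≡ g
  ψ₀-ψ₀⁻¹ (j , s) with membership j s
  ... | member ej = begin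
    ψ₀ (ψ₀⁻¹ (j , s))                   ≡⟨ cong ψ₀ (ψ₀⁻¹-member j s ej) ⟩
    ψ₀ (j ⊕ (⊖ z1) , not s)             ≡⟨ ψ₀-member (j ⊕ (⊖ z1)) (not s) (-1-parity j ej) ⟩
    ((j ⊕ (⊖ z1)) ⊕ z1 , not (not s))
      ≡⟨ cong₂ _,_ (solve 1 (λ j → (j :- :1) :+ :1 := j) refl j) (not-involutive s) ⟩
    (j , s)                             ∎
    where open ≡-Reasoning
  ... | nonmember ej = begin
    ψ₀ (ψ₀⁻¹ (j , s))                   ≡⟨ cong ψ₀ (ψ₀⁻¹-nonmember j s ej) ⟩
    ψ₀ (⊖ j , s)                        ≡⟨ ψ₀-nonmember (⊖ j) s (⊖-parity j ej) ⟩
    (⊖ (⊖ j) , s)                       ≡⟨ cong (_, s) (⊖-involutive j) ⟩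
    (j , s)                             ∎
    where open ≡-Reasoning

  ψ₀-involutive-nonmember : ∀ l {t} → isEven l ≡ not t → ψ₀ (ψ₀ (l , t)) ≡ (l , t)
  ψ₀-involutive-nonmember l {t} el = begin
    ψ₀ (ψ₀ (l , t))     ≡⟨ cong ψ₀ (ψ₀-nonmember l t el) ⟩
    ψ₀ (⊖ l , t)        ≡⟨ ψ₀-nonmember (⊖ l) t (⊖-parity l el) ⟩
    (⊖ (⊖ l) , t)       ≡⟨ cong (_, t) (⊖-involutive l) ⟩
    (l , t)             ∎
    where open ≡-Reasoning

  ψ₀-e : ψ₀ e ≡ e
  ψ₀-e = trans (ψ₀-nonmember z0 false isEven-z0) (cong (_, false) (solve 0 (:- :0 := :0) refl))

  ψ₀-x : ∀ k → ψ₀ (x k) ≡ x (pos-p k)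
  ψ₀-x k = trans (ψ₀-member k (isEven k) refl) (cong (k ⊕ z1 ,_) (sym (+1-parity k refl)))

  pos-p-iterate : ∀ t k → (pos-p ^[ t ]) k ≡ k ⊕ (t mod n)
  pos-p-iterate zero    k = sym (solve 1 (λ k → k :+ :0 := k) refl k)
  pos-p-iterate (suc t) k = begin
    ((pos-p ^[ t ]) k) ⊕ z1    ≡⟨ cong (_⊕ z1) (pos-p-iterate t k) ⟩
    (k ⊕ (t mod n)) ⊕ z1       ≡⟨ solve 2 (λ k u → (k :+ u) :+ :1 := k :+ (u :+ :1)) refl k (t mod n) ⟩
    k ⊕ ((t mod n) ⊕ z1)       ≡⟨ cong (k ⊕_) (sym (mod-homo-+ t 1)) ⟩
    k ⊕ ((t + 1) mod n)        ≡⟨ cong (λ u → k ⊕ (u mod n)) (ℕ.+-comm t 1) ⟩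
    k ⊕ (suc t mod n)          ∎
    where open ≡-Reasoning

  ψ₀-iterate-x : ∀ t k → (ψ₀ ^[ t ]) (x k) ≡ x (k ⊕ (t mod n))
  ψ₀-iterate-x t k = trans (^[]-semiconj x ψ₀-x t k) (cong x (pos-p-iterate t k))

  ψ₀-iterate-b : ∀ t → toℕ (proj₁ ((ψ₀ ^[ t ]) (x z0))) ≡ t % n
  ψ₀-iterate-b t = begin
    toℕ (proj₁ ((ψ₀ ^[ t ]) (x z0)))   ≡⟨ cong (toℕ ∘ proj₁) (ψ₀-iterate-x t z0) ⟩
    toℕ (z0 ⊕ (t mod n))               ≡⟨ cong toℕ (solve 1 (λ u → :0 :+ u := u) refl (t mod n)) ⟩
    toℕ (t mod n)                      ≡⟨ toℕ-mod t ⟩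
    t % n                              ∎
    where open ≡-Reasoning

  ψ₀-iterate-member : ∀ l {t} c → isEven l ≡ t → isEven c ≡ false →
                      (ψ₀ ^[ toℕ c ]) (l , t) ≡ (l ⊕ c , not t)
  ψ₀-iterate-member l {t} c el ec = begin
    (ψ₀ ^[ toℕ c ]) (l , t)    ≡⟨ cong (λ s → (ψ₀ ^[ toℕ c ]) (l , s)) (sym el) ⟩
    (ψ₀ ^[ toℕ c ]) (x l)      ≡⟨ ψ₀-iterate-x (toℕ c) l ⟩
    x (l ⊕ (toℕ c mod n))      ≡⟨ cong (λ u → x (l ⊕ u)) (toℕ-mod-id c) ⟩
    x (l ⊕ c)                  ≡⟨ cong (l ⊕ c ,_) (trans (⊕-parity l c el ec) (cong not (xor-identityʳ t))) ⟩
    (l ⊕ c , not t)            ∎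
    where open ≡-Reasoning

  ψ₀-iterate-nonmember : ∀ l {t} c → isEven l ≡ not t → isEven c ≡ false →
                         (ψ₀ ^[ toℕ c ]) (l , t) ≡ (⊖ l , t)
  ψ₀-iterate-nonmember l {t} c el ec = begin
    (ψ₀ ^[ toℕ c ]) (l , t)       ≡⟨ ^[]-involution ψ₀ (ψ₀-involutive-nonmember l el) (toℕ c) ⟩
    (ψ₀ ^[ toℕ c % 2 ]) (l , t)   ≡⟨ cong (λ r → (ψ₀ ^[ r ]) (l , t)) (odd⇒%2≡1 c ec) ⟩
    ψ₀ (l , t)                    ≡⟨ ψ₀-nonmember l t el ⟩
    (⊖ l , t)                     ∎
    where open ≡-Reasoning

  πₙ : G → Fin n
  πₙ (j , false) = (j ⊕ j) ⊕ z1
  πₙ (j , true)  = ⊖ ((j ⊕ j) ⊕ z1)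

  π₀ : G → ℕ
  π₀ g = toℕ (πₙ g)

  πₙ-odd : ∀ g → isEven (πₙ g) ≡ false
  πₙ-odd (j , false) = ⊕-parity (j ⊕ j) z1 (trans (isEven-⊕ j j) (cong not (xor-same (isEven j)))) isEven-z1
  πₙ-odd (j , true)  = ⊖-parity ((j ⊕ j) ⊕ z1) (πₙ-odd (j , false))

  skew-via : ∀ g h {u v w} → ψ₀ (g · h) ≡ u → ψ₀ g ≡ v → (ψ₀ ^[ π₀ g ]) h ≡ w →
             u ≡ v · w → ψ₀ (g · h) ≡ ψ₀ g · (ψ₀ ^[ π₀ g ]) h
  skew-via _ _ p q r eq = trans p (trans eq (sym (cong₂ _·_ q r)))

  -- Membership of g · h in X is determined by that of g and h; in each case the first components
  -- agree by a ring identity in ℤ/n.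
  skew₀ : ∀ g h → ψ₀ (g · h) ≡ ψ₀ g · (ψ₀ ^[ π₀ g ]) h
  skew₀ (j , s) (l , t) = by-membership s (membership j s) (membership l t)
    where
    iterate-member : ∀ s → isEven l ≡ t → (ψ₀ ^[ π₀ (j , s) ]) (l , t) ≡ (l ⊕ πₙ (j , s) , not t)
    iterate-member s el = ψ₀-iterate-member l (πₙ (j , s)) el (πₙ-odd (j , s))
    iterate-nonmember : ∀ s → isEven l ≡ not t → (ψ₀ ^[ π₀ (j , s) ]) (l , t) ≡ (⊖ l , t)
    iterate-nonmember s el = ψ₀-iterate-nonmember l (πₙ (j , s)) el (πₙ-odd (j , s))
    by-membership : ∀ s → Membership j s → Membership l t →
                    ψ₀ ((j , s) · (l , t)) ≡ ψ₀ (j , s) · (ψ₀ ^[ π₀ (j , s) ]) (l , t)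
    by-membership false (member ej) (member el) = skew-via (j , false) (l , t)
      (ψ₀-nonmember (j ⊕ l) t (⊕-parity j l ej el)) (ψ₀-member j false ej) (iterate-member false el)
      (cong₂ _,_ (solve 2 (λ j l → :- (j :+ l) := (j :+ :1) :- (l :+ ((j :+ j) :+ :1))) refl j l)
                 (sym (not-involutive t)))
    by-membership false (member ej) (nonmember el) = skew-via (j , false) (l , t)
      (ψ₀-member (j ⊕ l) t (trans (⊕-parity j l ej el) (not-involutive t))) (ψ₀-member j false ej)
      (iterate-nonmember false el)
      (cong (_, not t) (solve 2 (λ j l → (j :+ l) :+ :1 := (j :+ :1) :- (:- l)) refl j l))
    by-membership false (nonmember ej) (member el) = skew-via (j , false) (l , t)
      (ψ₀-member (j ⊕ l) t (trans (⊕-parity j l ej el) (not-involutive t))) (ψ₀-nonmember j false ej)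
      (iterate-member false el)
      (cong (_, not t) (solve 2 (λ j l → (j :+ l) :+ :1 := :- j :+ (l :+ ((j :+ j) :+ :1))) refl j l))
    by-membership false (nonmember ej) (nonmember el) = skew-via (j , false) (l , t)
      (ψ₀-nonmember (j ⊕ l) t (trans (⊕-parity j l ej el) (cong not (not-involutive t))))
      (ψ₀-nonmember j false ej) (iterate-nonmember false el)
      (cong (_, t) (solve 2 (λ j l → :- (j :+ l) := :- j :- l) refl j l))
    by-membership true (member ej) (member el) = skew-via (j , true) (l , t)
      (ψ₀-nonmember (j ⊕ (⊖ l)) (not t) (⊕-parity j (⊖ l) ej (⊖-parity l el))) (ψ₀-member j true ej)
      (iterate-member true el)
      (cong (_, not t) (solve 2 (λ j l → :- (j :- l) := (j :+ :1) :+ (l :- ((j :+ j) :+ :1))) refl j l))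
    by-membership true (member ej) (nonmember el) = skew-via (j , true) (l , t)
      (ψ₀-member (j ⊕ (⊖ l)) (not t)
        (trans (⊕-parity j (⊖ l) ej (⊖-parity l el)) (cong not (not-involutive t))))
      (ψ₀-member j true ej) (iterate-nonmember true el)
      (cong₂ _,_ (solve 2 (λ j l → (j :- l) :+ :1 := (j :+ :1) :- l) refl j l) (not-involutive t))
    by-membership true (nonmember ej) (member el) = skew-via (j , true) (l , t)
      (ψ₀-member (j ⊕ (⊖ l)) (not t) (⊕-parity j (⊖ l) ej (⊖-parity l el))) (ψ₀-nonmember j true ej)
      (iterate-member true el)
      (cong (_, not (not t)) (solve 2 (λ j l → (j :- l) :+ :1 := :- j :- (l :- ((j :+ j) :+ :1))) refl j l))
    by-membership true (nonmember ej) (nonmember el) = skew-via (j , true) (l , t)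
      (ψ₀-nonmember (j ⊕ (⊖ l)) (not t) (⊕-parity j (⊖ l) ej (⊖-parity l el)))
      (ψ₀-nonmember j true ej) (iterate-nonmember true el)
      (cong (_, not t) (solve 2 (λ j l → :- (j :- l) := :- j :- (:- l)) refl j l))

  ψ₀-period : ∀ g → (ψ₀ ^[ n ]) g ≡ g
  ψ₀-period (l , t) with membership l t
  ... | member el = begin
    (ψ₀ ^[ n ]) (l , t)        ≡⟨ cong (λ s → (ψ₀ ^[ n ]) (l , s)) (sym el) ⟩
    (ψ₀ ^[ n ]) (x l)          ≡⟨ ψ₀-iterate-x n l ⟩
    x (l ⊕ (n mod n))          ≡⟨ cong (λ u → x (l ⊕ u)) (mod-cong ([m+n]%n≡m%n 0 n)) ⟩
    x (l ⊕ z0)                 ≡⟨ cong x (solve 1 (λ l → l :+ :0 := l) refl l) ⟩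
    x l                        ≡⟨ cong (l ,_) el ⟩
    (l , t)                    ∎
    where open ≡-Reasoning
  ... | nonmember el = begin
    (ψ₀ ^[ n ]) (l , t)        ≡⟨ ^[]-involution ψ₀ (ψ₀-involutive-nonmember l el) n ⟩
    (ψ₀ ^[ n % 2 ]) (l , t)    ≡⟨ cong (λ r → (ψ₀ ^[ r ]) (l , t)) (n∣m⇒m%n≡0 n 2 2∣n) ⟩
    (l , t)                    ∎
    where open ≡-Reasoning

  ψ₀-aperiodic : ∀ t → 1 ≤ t → t < n → ¬ (∀ g → (ψ₀ ^[ t ]) g ≡ g)
  ψ₀-aperiodic t 1≤t t<n fixes = ℕ.<⇒≢ 1≤t (begin
    0                                  ≡⟨ sym toℕ-z0 ⟩
    toℕ (proj₁ (x z0))                 ≡⟨ cong (toℕ ∘ proj₁) (sym (fixes (x z0))) ⟩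
    toℕ (proj₁ ((ψ₀ ^[ t ]) (x z0)))   ≡⟨ ψ₀-iterate-b t ⟩
    t % n                              ≡⟨ m<n⇒m%n≡m t<n ⟩
    t                                  ∎)
    where open ≡-Reasoning

  ψ₀-order : IsOrder ψ₀ n
  ψ₀-order = ℕ.<⇒≤ 1<n , ψ₀-period , ψ₀-aperiodic

  ψ₀-isSkew : IsSkew ψ₀ π₀
  ψ₀-isSkew = record
    { ψ⁻ = ψ₀⁻¹ ; invl = ψ₀⁻¹-ψ₀ ; invr = ψ₀-ψ₀⁻¹ ; fix1 = ψ₀-e
    ; order = n ; isOrder = ψ₀-order
    ; π-range = λ g → odd⇒positive (πₙ g) (πₙ-odd g) , ℕ.<⇒≤ (toℕ<n (πₙ g))
    ; skew = skew₀ }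

  ψ₀-associated : IsAssociated ψ₀
  ψ₀-associated = (π₀ , ψ₀-isSkew) , ψ₀-x

  -- Automorphisms of the map and regularity

  id-auto : Auto
  id-auto = record
    { f = λ d → d ; f⁻ = λ d → d ; left = λ _ → refl ; right = λ _ → refl
    ; comR = λ _ → refl ; comRev = λ _ → refl }

  _∘-auto_ : Auto → Auto → Auto
  φ ∘-auto χ = record
    { f = f φ ∘ f χ ; f⁻ = f⁻ χ ∘ f⁻ φ
    ; left = λ d → trans (cong (f⁻ χ) (left φ (f χ d))) (left χ d)
    ; right = λ d → trans (cong (f φ) (right χ (f⁻ φ d))) (right φ d)
    ; comR = λ d → trans (cong (f φ) (comR χ d)) (comR φ (f χ d))
    ; comRev = λ d → trans (cong (f φ) (comRev χ d)) (comRev φ (f χ d)) }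

  inverse-auto : Auto → Auto
  inverse-auto φ = record
    { f = f⁻ φ ; f⁻ = f φ ; left = right φ ; right = left φ
    ; comR = inverse-commutes (comR φ) ; comRev = inverse-commutes (comRev φ) }
    where
    inverse-commutes : ∀ {T} → (∀ d → f φ (T d) ≡ T (f φ d)) → ∀ d → f⁻ φ (T d) ≡ T (f⁻ φ d)
    inverse-commutes {T} commutes d = begin
      f⁻ φ (T d)                    ≡⟨ cong (f⁻ φ ∘ T) (sym (right φ d)) ⟩
      f⁻ φ (T (f φ (f⁻ φ d)))       ≡⟨ cong (f⁻ φ) (sym (commutes (f⁻ φ d))) ⟩
      f⁻ φ (f φ (T (f⁻ φ d)))       ≡⟨ left φ (T (f⁻ φ d)) ⟩
      T (f⁻ φ d)                    ∎
      where open ≡-Reasoning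

  L : G → Auto
  L g = record
    { f = λ d → (g · proj₁ d , proj₂ d)
    ; f⁻ = λ d → ((g ⁻¹) · proj₁ d , proj₂ d)
    ; left = λ d → cong (_, proj₂ d) (\\-leftDividesʳ g (proj₁ d))
    ; right = λ d → cong (_, proj₂ d) (\\-leftDividesˡ g (proj₁ d))
    ; comR = λ _ → refl
    ; comRev = λ d → cong (_, idx ((x (proj₂ d)) ⁻¹)) (sym (·-assoc g (proj₁ d) (x (proj₂ d)))) }

  idx-x⁻¹-even : ∀ k → isEven k ≡ true → idx ((x k) ⁻¹) ≡ k
  idx-x⁻¹-even k ek = cong (λ s → idx ((k , s) ⁻¹)) ek

  idx-x⁻¹-odd : ∀ k → isEven k ≡ false → idx ((x k) ⁻¹) ≡ ⊖ k
  idx-x⁻¹-odd k ek = cong (λ s → idx ((k , s) ⁻¹)) ek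

  skew₀-x : ∀ g k → ψ₀ (g · x k) ≡ ψ₀ g · x (k ⊕ πₙ g)
  skew₀-x g k = trans (skew₀ g (x k)) (cong (ψ₀ g ·_)
    (trans (ψ₀-iterate-x (π₀ g) k) (cong (λ u → x (k ⊕ u)) (toℕ-mod-id (πₙ g)))))

  πₙ-Rev-index : ∀ g k → idx ((x k) ⁻¹) ⊕ πₙ (g · x k) ≡ idx ((x (k ⊕ πₙ g)) ⁻¹)
  πₙ-Rev-index g k = at g (isEven k) refl
    where
    shifted-parity : ∀ g {s} → isEven k ≡ s → isEven (k ⊕ πₙ g) ≡ not (s xor false)
    shifted-parity g ek = ⊕-parity k (πₙ g) ek (πₙ-odd g)
    at : ∀ g s → isEven k ≡ s → idx ((k , s) ⁻¹) ⊕ πₙ (g · (k , s)) ≡ idx ((x (k ⊕ πₙ g)) ⁻¹)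
    at (j , false) true ek = trans
      (solve 2 (λ k j → k :- (((j :+ k) :+ (j :+ k)) :+ :1) := :- (k :+ ((j :+ j) :+ :1))) refl k j)
      (sym (idx-x⁻¹-odd (k ⊕ πₙ (j , false)) (shifted-parity (j , false) ek)))
    at (j , false) false ek = trans
      (solve 2 (λ k j → :- k :+ (((j :+ k) :+ (j :+ k)) :+ :1) := k :+ ((j :+ j) :+ :1)) refl k j)
      (sym (idx-x⁻¹-even (k ⊕ πₙ (j , false)) (shifted-parity (j , false) ek)))
    at (j , true) true ek = trans
      (solve 2 (λ k j → k :+ (((j :- k) :+ (j :- k)) :+ :1) := :- (k :- ((j :+ j) :+ :1))) refl k j)
      (sym (idx-x⁻¹-odd (k ⊕ πₙ (j , true)) (shifted-parity (j , true) ek)))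
    at (j , true) false ek = trans
      (solve 2 (λ k j → :- k :- (((j :- k) :+ (j :- k)) :+ :1) := k :- ((j :+ j) :+ :1)) refl k j)
      (sym (idx-x⁻¹-even (k ⊕ πₙ (j , true)) (shifted-parity (j , true) ek)))

  -- The automorphism induced by the skew-morphism: it fixes the vertex e and acts there as R.
  Φ : Auto
  Φ = record
    { f = λ (g , k) → (ψ₀ g , k ⊕ πₙ g)
    ; f⁻ = λ (g , k) → (ψ₀⁻¹ g , k ⊕ (⊖ (πₙ (ψ₀⁻¹ g))))
    ; left = λ (g , k) → trans (cong (λ h → (h , (k ⊕ πₙ g) ⊕ (⊖ (πₙ h)))) (ψ₀⁻¹-ψ₀ g))
                               (cong (g ,_) (solve 2 (λ k π → (k :+ π) :- π := k) refl k (πₙ g)))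
    ; right = λ (g , k) → cong₂ _,_ (ψ₀-ψ₀⁻¹ g)
                            (solve 2 (λ k π → (k :- π) :+ π := k) refl k (πₙ (ψ₀⁻¹ g)))
    ; comR = λ (g , k) → cong (ψ₀ g ,_)
                           (solve 2 (λ k π → (k :+ :1) :+ π := (k :+ π) :+ :1) refl k (πₙ g))
    ; comRev = λ (g , k) → cong₂ _,_ (skew₀-x g k) (πₙ-Rev-index g k) }

  Φ^ : ℕ → Auto
  Φ^ zero    = id-auto
  Φ^ (suc t) = Φ ∘-auto Φ^ t

  Φ^-at-e : ∀ t k → f (Φ^ t) (e , k) ≡ (e , k ⊕ (t mod n))
  Φ^-at-e t k = trans (rotates t) (cong (e ,_) (pos-p-iterate t k))
    where
    rotates : ∀ t → f (Φ^ t) (e , k) ≡ (e , (pos-p ^[ t ]) k)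
    rotates zero    = refl
    rotates (suc t) = trans (cong (f Φ) (rotates t)) (cong₂ _,_ ψ₀-e
      (cong ((pos-p ^[ t ]) k ⊕_) (solve 0 ((:0 :+ :0) :+ :1 := :1) refl)))

  regular : Regular
  regular (g , k) (g′ , k′) = L g′ ∘-auto (Φ^ t ∘-auto L (g ⁻¹)) ,
    trans (cong (λ d → (g′ · proj₁ d , proj₂ d)) rotated) (cong (_, k′) (·-identityʳ g′))
    where
    t = toℕ (k′ ⊕ (⊖ k))
    rotated : f (Φ^ t) ((g ⁻¹) · g , k) ≡ (e , k′)
    rotated = begin
      f (Φ^ t) ((g ⁻¹) · g , k)   ≡⟨ cong (λ h → f (Φ^ t) (h , k)) (·-inverseˡ g) ⟩
      f (Φ^ t) (e , k)            ≡⟨ Φ^-at-e t k ⟩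
      (e , k ⊕ (t mod n))         ≡⟨ cong (λ u → (e , k ⊕ u)) (toℕ-mod-id (k′ ⊕ (⊖ k))) ⟩
      (e , k ⊕ (k′ ⊕ (⊖ k)))      ≡⟨ cong (e ,_) (solve 2 (λ k k′ → k :+ (k′ :- k) := k′) refl k k′) ⟩
      (e , k′)                    ∎
      where open ≡-Reasoning

  -- The core of L(Cₙ)

  R-iterate : ∀ t g k → (R ^[ t ]) (g , k) ≡ (g , k ⊕ (t mod n))
  R-iterate t g k = trans (^[]-semiconj (g ,_) (λ _ → refl) t k) (cong (g ,_) (pos-p-iterate t k))

  Rev-even : ∀ g k → isEven k ≡ true → Rev (g , k) ≡ (g · a^ k b , k)
  Rev-even g k ek = cong (λ s → (g · (k , s) , idx ((k , s) ⁻¹))) ek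

  Rev-odd : ∀ g k → isEven k ≡ false → Rev (g , k) ≡ (g · a^ k , ⊖ k)
  Rev-odd g k ek = cong (λ s → (g · (k , s) , idx ((k , s) ⁻¹))) ek

  -- Half a turn around a vertex of valency n = 2m, along the edge, and again: a walk built from R
  -- and Rev alone, so every automorphism commutes with it.
  zigzag : Dart → Dart
  zigzag d = Rev ((R ^[ m ]) (Rev ((R ^[ m ]) d)))

  zigzag-commutes : ∀ φ d → f φ (zigzag d) ≡ zigzag (f φ d)
  zigzag-commutes φ d = begin
    f φ (Rev (Rᵐ (Rev (Rᵐ d))))    ≡⟨ comRev φ _ ⟩
    Rev (f φ (Rᵐ (Rev (Rᵐ d))))    ≡⟨ cong Rev (Rᵐ-commutes _) ⟩
    Rev (Rᵐ (f φ (Rev (Rᵐ d))))    ≡⟨ cong (Rev ∘ Rᵐ) (comRev φ _) ⟩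
    Rev (Rᵐ (Rev (f φ (Rᵐ d))))    ≡⟨ cong (Rev ∘ Rᵐ ∘ Rev) (Rᵐ-commutes d) ⟩
    Rev (Rᵐ (Rev (Rᵐ (f φ d))))    ∎
    where
    open ≡-Reasoning
    Rᵐ = R ^[ m ]
    Rᵐ-commutes : ∀ d → f φ (Rᵐ d) ≡ Rᵐ (f φ d)
    Rᵐ-commutes d = sym (^[]-semiconj (f φ) (λ d → sym (comR φ d)) m d)

  zigzag-translates : 2 ∣ m → ∀ d → zigzag d ≡ (a^ m' · proj₁ d , proj₂ d)
  zigzag-translates 2∣m (g , k) = by-parity (isEven k) refl
    where
    Rᵐ = R ^[ m ]
    k₁ = k ⊕ m'
    m'-even : isEven m' ≡ true
    m'-even = Equivalence.from isEven-m'⇔2∣m 2∣m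
    k+m'+m' : (k ⊕ m') ⊕ m' ≡ k
    k+m'+m' = begin
      (k ⊕ m') ⊕ m'     ≡⟨ solve 2 (λ k u → (k :+ u) :+ u := k :+ (u :+ u)) refl k m' ⟩
      k ⊕ (m' ⊕ m')     ≡⟨ cong (k ⊕_) m'⊕m' ⟩
      k ⊕ z0            ≡⟨ solve 1 (λ k → k :+ :0 := k) refl k ⟩
      k                 ∎
      where open ≡-Reasoning
    by-parity : ∀ b → isEven k ≡ b → zigzag (g , k) ≡ (a^ m' · g , k)
    by-parity true ek = begin
      Rev (Rᵐ (Rev (Rᵐ (g , k))))                 ≡⟨ cong (Rev ∘ Rᵐ ∘ Rev) (R-iterate m g k) ⟩
      Rev (Rᵐ (Rev (g , k₁)))                     ≡⟨ cong (Rev ∘ Rᵐ) (Rev-even g k₁ e₁) ⟩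
      Rev (Rᵐ (g · a^ k₁ b , k₁))                 ≡⟨ cong Rev (R-iterate m (g · a^ k₁ b) k₁) ⟩
      Rev (g · a^ k₁ b , k₁ ⊕ m')                 ≡⟨ Rev-even (g · a^ k₁ b) (k₁ ⊕ m') e₂ ⟩
      ((g · a^ k₁ b) · a^ (k₁ ⊕ m') b , k₁ ⊕ m')
        ≡⟨ cong₂ _,_ (·-assoc g (a^ k₁ b) (a^ (k₁ ⊕ m') b)) k+m'+m' ⟩
      (g · a^ (k₁ ⊕ (⊖ (k₁ ⊕ m'))) , k)           ≡⟨ cong (λ i → (g · a^ i , k)) k₁-shift ⟩
      (g · a^ m' , k)                             ≡⟨ cong (_, k) (m'-central g) ⟩
      (a^ m' · g , k)                             ∎
      where
      open ≡-Reasoning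
      e₁ = ⊕-parity k m' ek m'-even
      e₂ = ⊕-parity k₁ m' e₁ m'-even
      k₁-shift : k₁ ⊕ (⊖ (k₁ ⊕ m')) ≡ m'
      k₁-shift = trans (solve 2 (λ k₁ u → k₁ :- (k₁ :+ u) := :- u) refl k₁ m') ⊖m'≡m'
    by-parity false ek = begin
      Rev (Rᵐ (Rev (Rᵐ (g , k))))                 ≡⟨ cong (Rev ∘ Rᵐ ∘ Rev) (R-iterate m g k) ⟩
      Rev (Rᵐ (Rev (g , k₁)))                     ≡⟨ cong (Rev ∘ Rᵐ) (Rev-odd g k₁ e₁) ⟩
      Rev (Rᵐ (g · a^ k₁ , ⊖ k₁))                 ≡⟨ cong Rev (R-iterate m (g · a^ k₁) (⊖ k₁)) ⟩
      Rev (g · a^ k₁ , k₃)                        ≡⟨ Rev-odd (g · a^ k₁) k₃ e₃ ⟩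
      ((g · a^ k₁) · a^ k₃ , ⊖ k₃)                ≡⟨ cong₂ _,_ (·-assoc g (a^ k₁) (a^ k₃)) ⊖k₃≡k ⟩
      (g · a^ (k₁ ⊕ k₃) , k)                      ≡⟨ cong (λ i → (g · a^ i , k)) k₁+k₃≡m' ⟩
      (g · a^ m' , k)                             ≡⟨ cong (_, k) (m'-central g) ⟩
      (a^ m' · g , k)                             ∎
      where
      open ≡-Reasoning
      k₃ = (⊖ k₁) ⊕ m'
      e₁ = ⊕-parity k m' ek m'-even
      ⊖k₃≡k : ⊖ k₃ ≡ k
      ⊖k₃≡k = solve 2 (λ k u → :- (:- (k :+ u) :+ u) := k) refl k m'
      k₁+k₃≡m' : k₁ ⊕ k₃ ≡ m'
      k₁+k₃≡m' = solve 2 (λ k u → (k :+ u) :+ (:- (k :+ u) :+ u) := u) refl k m'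
      e₃ = ⊕-parity (⊖ k₁) m' (⊖-parity k₁ e₁) m'-even

  N₀ : Fin n → Set
  N₀ c = c ≡ z0 ⊎ (c ≡ m' × 2 ∣ m)

  N₀-⊕ : ∀ {c c′} → N₀ c → N₀ c′ → N₀ (c ⊕ c′)
  N₀-⊕ (inj₁ refl)       (inj₁ refl)       = inj₁ (solve 0 (:0 :+ :0 := :0) refl)
  N₀-⊕ (inj₁ refl)       (inj₂ (refl , d)) = inj₂ (solve 1 (λ u → :0 :+ u := u) refl m' , d)
  N₀-⊕ (inj₂ (refl , d)) (inj₁ refl)       = inj₂ (solve 1 (λ u → u :+ :0 := u) refl m' , d)
  N₀-⊕ (inj₂ (refl , _)) (inj₂ (refl , _)) = inj₁ m'⊕m'

  N₀-⊖ : ∀ {c} → N₀ c → N₀ (⊖ c)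
  N₀-⊖ (inj₁ refl)       = inj₁ (solve 0 (:- :0 := :0) refl)
  N₀-⊖ (inj₂ (refl , d)) = inj₂ (⊖m'≡m' , d)

  IsL-inverse : ∀ g φ → IsL g φ → ∀ d → f⁻ φ d ≡ ((g ⁻¹) · proj₁ d , proj₂ d)
  IsL-inverse g φ Lφ d = cong₂ _,_
    (trans (sym (\\-leftDividesʳ g (proj₁ (f⁻ φ d)))) (cong (λ d′ → (g ⁻¹) · proj₁ d′) φφ⁻¹d))
    (cong proj₂ φφ⁻¹d)
    where
    φφ⁻¹d : (g · proj₁ (f⁻ φ d) , proj₂ (f⁻ φ d)) ≡ d
    φφ⁻¹d = trans (sym (Lφ (f⁻ φ d))) (right φ d)

  IsL-e⇔identity : ∀ σ → IsL e σ ⇔ (∀ d → f σ d ≡ d)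
  IsL-e⇔identity σ = mk⇔
    (λ Lσ d → trans (Lσ d) (cong (_, proj₂ d) (·-identityˡ (proj₁ d))))
    (λ σ≗id d → trans (σ≗id d) (cong (_, proj₂ d) (sym (·-identityˡ (proj₁ d)))))

  IsL-m'⇔zigzag : 2 ∣ m → ∀ σ → IsL (a^ m') σ ⇔ (∀ d → f σ d ≡ zigzag d)
  IsL-m'⇔zigzag 2∣m σ = mk⇔
    (λ Lσ d → trans (Lσ d) (sym (zigzag-translates 2∣m d)))
    (λ σ≗zigzag d → trans (σ≗zigzag d) (zigzag-translates 2∣m d))

  conjugate-of-central : ∀ φ σ T → (∀ d → f σ d ≡ T d) → (∀ d → f φ (T d) ≡ T (f φ d)) →
                         ∀ d → f φ (f σ (f⁻ φ d)) ≡ T d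
  conjugate-of-central φ σ T σ≗T commutes d = begin
    f φ (f σ (f⁻ φ d))    ≡⟨ cong (f φ) (σ≗T (f⁻ φ d)) ⟩
    f φ (T (f⁻ φ d))      ≡⟨ commutes (f⁻ φ d) ⟩
    T (f φ (f⁻ φ d))      ≡⟨ cong T (right φ d) ⟩
    T d                   ∎
    where open ≡-Reasoning

  LN₀-normal : IsNormalSubgroup (LOf N₀)
  LN₀-normal = record { has-id = has-id ; has-∘ = has-∘ ; has-inv = has-inv ; normal = normal }
    where
    has-id : ∀ χ → (∀ d → f χ d ≡ d) → LOf N₀ χ
    has-id χ χ≗id = z0 , inj₁ refl , Equivalence.from (IsL-e⇔identity χ) χ≗id
    has-∘ : ∀ φ ψ χ → LOf N₀ φ → LOf N₀ ψ → (∀ d → f χ d ≡ f φ (f ψ d)) → LOf N₀ χ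
    has-∘ φ ψ χ (c , Nc , Lφ) (c′ , Nc′ , Lψ) χ≗φψ = c ⊕ c′ , N₀-⊕ Nc Nc′ , λ d →
      trans (χ≗φψ d) (trans (cong (f φ) (Lψ d))
        (trans (Lφ _) (cong (_, proj₂ d) (sym (·-assoc (a^ c) (a^ c′) (proj₁ d))))))
    has-inv : ∀ φ χ → LOf N₀ φ → (∀ d → f χ d ≡ f⁻ φ d) → LOf N₀ χ
    has-inv φ χ (c , Nc , Lφ) χ≗φ⁻¹ =
      ⊖ c , N₀-⊖ Nc , λ d → trans (χ≗φ⁻¹ d) (IsL-inverse (a^ c) φ Lφ d)
    normal : ∀ φ σ χ → LOf N₀ σ → (∀ d → f χ d ≡ f φ (f σ (f⁻ φ d))) → LOf N₀ χ
    normal φ σ χ (c , inj₁ refl , Lσ) χ≗φσφ⁻¹ =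
      z0 , inj₁ refl , Equivalence.from (IsL-e⇔identity χ) λ d → trans (χ≗φσφ⁻¹ d)
        (conjugate-of-central φ σ (λ d → d) (Equivalence.to (IsL-e⇔identity σ) Lσ) (λ _ → refl) d)
    normal φ σ χ (c , inj₂ (refl , 2∣m) , Lσ) χ≗φσφ⁻¹ =
      m' , inj₂ (refl , 2∣m) , Equivalence.from (IsL-m'⇔zigzag 2∣m χ) λ d → trans (χ≗φσφ⁻¹ d)
        (conjugate-of-central φ σ zigzag (Equivalence.to (IsL-m'⇔zigzag 2∣m σ) Lσ) (zigzag-commutes φ) d)

  halves-of-zero : ∀ c → c ⊕ c ≡ z0 → c ≡ z0 ⊎ c ≡ m'
  halves-of-zero c c+c≡0 with m%n≡0⇒n∣m (a + a) n a+a%n≡0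
    where
    a = toℕ c
    a+a%n≡0 : (a + a) % n ≡ 0
    a+a%n≡0 = trans (sym (toℕ-mod (a + a))) (trans (cong toℕ c+c≡0) toℕ-z0)
  ... | divides zero a+a≡0 =
    inj₁ (toℕ-injective (trans (ℕ.m+n≡0⇒m≡0 (toℕ c) a+a≡0) (sym toℕ-z0)))
  ... | divides (suc zero) a+a≡n =
    inj₂ (toℕ-injective (trans (ℕ.*-cancelˡ-≡ (toℕ c) m 2 2a≡2m) (sym toℕ-m')))
    where
    2a≡2m : 2 * toℕ c ≡ 2 * m
    2a≡2m = trans (cong (λ b → toℕ c + b) (ℕ.+-identityʳ (toℕ c))) (trans a+a≡n (ℕ.+-identityʳ n))
  ... | divides (suc (suc q)) a+a≡big = ⊥-elim (ℕ.<-irrefl a+a≡big (ℕ.<-≤-trans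
    (ℕ.+-mono-< (toℕ<n c) (toℕ<n c)) (ℕ.+-monoʳ-≤ n (ℕ.m≤m+n n (q * n)))))

  ψ₀-rotation⇒even : ∀ c → proj₂ (ψ₀ (a^ c)) ≡ false → isEven c ≡ true
  ψ₀-rotation⇒even c ψ₀c-rotation with membership c false
  ... | nonmember ec = ec
  ... | member ec    = contradiction (trans (cong proj₂ (sym (ψ₀-member c false ec))) ψ₀c-rotation) λ ()

  Φ-conjugate : Auto → Auto
  Φ-conjugate σ = Φ ∘-auto (σ ∘-auto inverse-auto Φ)

  Φ-conjugate-of-translation : ∀ c c′ σ → IsL (a^ c) σ → IsL (a^ c′) (Φ-conjugate σ) →
                               f Φ (a^ c , z0) ≡ (a^ c′ · ψ₀ e , z0 ⊕ πₙ e)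
  Φ-conjugate-of-translation c c′ σ Lσ Lχ = begin
    f Φ (a^ c , z0)                    ≡⟨ cong (λ g → f Φ (g , z0)) (sym (·-identityʳ (a^ c))) ⟩
    f Φ (a^ c · e , z0)                ≡⟨ cong (f Φ) (sym (Lσ (e , z0))) ⟩
    f Φ (f σ (e , z0))                 ≡⟨ cong (f Φ ∘ f σ) (sym (left Φ (e , z0))) ⟩
    f Φ (f σ (f⁻ Φ (f Φ (e , z0))))    ≡⟨ Lχ (f Φ (e , z0)) ⟩
    (a^ c′ · ψ₀ e , z0 ⊕ πₙ e)         ∎
    where open ≡-Reasoning

  -- Read off the two components of Φ-conjugate-of-translation: ψ₀(a^c) is a rotation, so c is
  -- even, and π₀(a^c) = π₀(e) = 1, so c ⊕ c ≡ z0.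
  Φ-conjugate-translation⇒N₀ : ∀ c c′ σ → IsL (a^ c) σ → IsL (a^ c′) (Φ-conjugate σ) → N₀ c
  Φ-conjugate-translation⇒N₀ c c′ σ Lσ Lχ = in-N₀ (halves-of-zero c c+c≡0)
    where
    open ≡-Reasoning
    conj = Φ-conjugate-of-translation c c′ σ Lσ Lχ
    c+c≡0 : c ⊕ c ≡ z0
    c+c≡0 = begin
      c ⊕ c                         ≡⟨ solve 1 (λ c → c :+ c := (:0 :+ ((c :+ c) :+ :1)) :- :1) refl c ⟩
      (z0 ⊕ πₙ (a^ c)) ⊕ (⊖ z1)     ≡⟨ cong (λ k → k ⊕ (⊖ z1)) (cong proj₂ conj) ⟩
      (z0 ⊕ πₙ e) ⊕ (⊖ z1)          ≡⟨ solve 0 ((:0 :+ ((:0 :+ :0) :+ :1)) :- :1 := :0) refl ⟩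
      z0                            ∎
    c-even : isEven c ≡ true
    c-even = ψ₀-rotation⇒even c (begin
      proj₂ (ψ₀ (a^ c))        ≡⟨ cong (proj₂ ∘ proj₁) conj ⟩
      proj₂ (a^ c′ · ψ₀ e)     ≡⟨ cong (λ g → proj₂ (a^ c′ · g)) ψ₀-e ⟩
      false                    ∎)
    in-N₀ : c ≡ z0 ⊎ c ≡ m' → N₀ c
    in-N₀ (inj₁ c≡z0) = inj₁ c≡z0
    in-N₀ (inj₂ c≡m') =
      inj₂ (c≡m' , Equivalence.to isEven-m'⇔2∣m (subst (λ c → isEven c ≡ true) c≡m' c-even))

  LN₀-maximal : ∀ S → IsNormalSubgroup S → InLCn S → ∀ σ → S σ → LOf N₀ σ
  LN₀-maximal S S-normal S⊆LCₙ σ Sσ with S⊆LCₙ σ Sσ | S⊆LCₙ (Φ-conjugate σ) Sχ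
    where
    Sχ : S (Φ-conjugate σ)
    Sχ = IsNormalSubgroup.normal S-normal Φ σ (Φ-conjugate σ) Sσ (λ _ → refl)
  ... | c , Lσ | c′ , Lχ = c , Φ-conjugate-translation⇒N₀ c c′ σ Lσ Lχ , Lσ

  N₀-isCore : IsCore N₀
  N₀-isCore = LN₀-normal , LN₀-maximal

  translation-unique : ∀ {c c′} σ → IsL (a^ c) σ → IsL (a^ c′) σ → c ≡ c′
  translation-unique {c} {c′} σ Lσ Lσ′ = cong proj₁ (begin
    a^ c            ≡⟨ sym (·-identityʳ (a^ c)) ⟩
    a^ c · e        ≡⟨ cong proj₁ (trans (sym (Lσ (e , z0))) (Lσ′ (e , z0))) ⟩
    a^ c′ · e       ≡⟨ ·-identityʳ (a^ c′) ⟩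
    a^ c′           ∎)
    where open ≡-Reasoning

  LOf⊆LCₙ : ∀ N → InLCn (LOf N)
  LOf⊆LCₙ N σ (c , _ , Lσ) = c , Lσ

  core-unique : ∀ N → IsCore N → ∀ c → N c ⇔ N₀ c
  core-unique N (LN-normal , LN-maximal) c = mk⇔
    (λ Nc → transport {N₀} (LN₀-maximal (LOf N) LN-normal (LOf⊆LCₙ N) (L (a^ c)) (L∈LOf N Nc)))
    (λ N₀c → transport {N} (LN-maximal (LOf N₀) LN₀-normal (LOf⊆LCₙ N₀) (L (a^ c)) (L∈LOf N₀ N₀c)))
    where
    L∈LOf : ∀ P → P c → LOf P (L (a^ c))
    L∈LOf P Pc = c , Pc , λ _ → refl
    transport : ∀ {P : Fin n → Set} → LOf P (L (a^ c)) → P c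
    transport {P} (c′ , Pc′ , Lc′) = subst P (translation-unique (L (a^ c)) Lc′ (λ _ → refl)) Pc′

  core-at-most-two : ∀ N → IsCore N → ∀ c₁ c₂ c₃ → N c₁ → N c₂ → N c₃ →
                     c₁ ≡ c₂ ⊎ c₁ ≡ c₃ ⊎ c₂ ≡ c₃
  core-at-most-two N N-core c₁ c₂ c₃ N₁ N₂ N₃ =
    pigeonhole (z0-or-m' N₁) (z0-or-m' N₂) (z0-or-m' N₃)
    where
    z0-or-m' : ∀ {c} → N c → c ≡ z0 ⊎ c ≡ m'
    z0-or-m' {c} Nc = Sum.map₂ proj₁ (Equivalence.to (core-unique N N-core c) Nc)

  core-trivial⇔m-odd : ∀ N → IsCore N →
                       (Σ (Fin n) (λ c → N c × (∀ c′ → N c′ → c′ ≡ c))) ⇔ (¬ 2 ∣ m)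
  core-trivial⇔m-odd N N-core = mk⇔
    (λ (c , _ , only-c) 2∣m →
       z0≢m' (trans (only-c z0 (from (inj₁ refl))) (sym (only-c m' (from (inj₂ (refl , 2∣m)))))))
    (λ m-odd → z0 , from (inj₁ refl) , λ c′ Nc′ →
       only-z0 m-odd (Equivalence.to (core-unique N N-core c′) Nc′))
    where
    from : ∀ {c} → N₀ c → N c
    from {c} = Equivalence.from (core-unique N N-core c)
    only-z0 : ∀ {c} → ¬ 2 ∣ m → N₀ c → c ≡ z0
    only-z0 _     (inj₁ c≡z0)      = c≡z0
    only-z0 m-odd (inj₂ (_ , 2∣m)) = contradiction 2∣m m-odd

  -- The power function

  IsOrder-unique : ∀ {ψ r r′} → IsOrder ψ r → IsOrder ψ r′ → r ≡ r′
  IsOrder-unique {r = r} {r′} (1≤r , id-r , min-r) (1≤r′ , id-r′ , min-r′) with ℕ.<-cmp r r′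
  ... | tri< r<r′ _ _ = ⊥-elim (min-r′ r 1≤r r<r′ id-r)
  ... | tri≈ _ r≡r′ _ = r≡r′
  ... | tri> _ _ r′<r = ⊥-elim (min-r r′ 1≤r′ r′<r id-r′)

  -- The skew identity at h = b determines π g modulo the order n of ψ₀.
  power-function-unique : ∀ {π} → IsSkew ψ₀ π → ∀ g → π g ≡ π₀ g
  power-function-unique {π} π-skew g =
    %-injective π≤n (odd⇒positive (πₙ g) (πₙ-odd g)) (toℕ<n (πₙ g)) (begin
      π g % n                                ≡⟨ sym (ψ₀-iterate-b (π g)) ⟩
      toℕ (proj₁ ((ψ₀ ^[ π g ]) (x z0)))     ≡⟨ cong (toℕ ∘ proj₁) same-iterate ⟩
      toℕ (proj₁ ((ψ₀ ^[ π₀ g ]) (x z0)))    ≡⟨ ψ₀-iterate-b (π₀ g) ⟩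
      π₀ g % n                               ∎)
    where
    open ≡-Reasoning
    open IsSkew π-skew
    π≤n : π g ≤ n
    π≤n = subst (π g ≤_) (IsOrder-unique isOrder ψ₀-order) (proj₂ (π-range g))
    same-iterate : (ψ₀ ^[ π g ]) (x z0) ≡ (ψ₀ ^[ π₀ g ]) (x z0)
    same-iterate = ∙-cancelˡ (ψ₀ g) _ _ (trans (sym (skew g (x z0))) (skew₀ g (x z0)))

  π₀≡1⇔πₙ≡z1 : ∀ g → π₀ g ≡ 1 ⇔ πₙ g ≡ z1
  π₀≡1⇔πₙ≡z1 g = mk⇔
    (λ π₀≡1 → toℕ-injective (trans π₀≡1 (sym toℕ-z1)))
    (λ πₙ≡z1 → trans (cong toℕ πₙ≡z1) toℕ-z1)

  aᵐ^ : Bool → G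
  aᵐ^ u = a^ (if u then m' else z0)

  [a⁻¹b]^ : Bool → G
  [a⁻¹b]^ v = if v then a^ (⊖ z1) b else e

  kernel-element : Bool × Bool → G
  kernel-element (u , v) = aᵐ^ u · [a⁻¹b]^ v

  aᵐ^-xor : ∀ u u′ → aᵐ^ (u xor u′) ≡ aᵐ^ u · aᵐ^ u′
  aᵐ^-xor false false = cong (_, false) (solve 0 (:0 := :0 :+ :0) refl)
  aᵐ^-xor false true  = cong (_, false) (solve 1 (λ u → u := :0 :+ u) refl m')
  aᵐ^-xor true  false = cong (_, false) (solve 1 (λ u → u := u :+ :0) refl m')
  aᵐ^-xor true  true  = cong (_, false) (sym m'⊕m')

  [a⁻¹b]^-xor : ∀ v v′ → [a⁻¹b]^ (v xor v′) ≡ [a⁻¹b]^ v · [a⁻¹b]^ v′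
  [a⁻¹b]^-xor false v′    = sym (·-identityˡ ([a⁻¹b]^ v′))
  [a⁻¹b]^-xor true  false = sym (·-identityʳ (a^ (⊖ z1) b))
  [a⁻¹b]^-xor true  true  = sym (·-inverseʳ (a^ (⊖ z1) b))

  aᵐ^-central : ∀ u g → aᵐ^ u · g ≡ g · aᵐ^ u
  aᵐ^-central false g = trans (·-identityˡ g) (sym (·-identityʳ g))
  aᵐ^-central true  g = sym (m'-central g)

  kernel-element-xor : ∀ u v → kernel-element ((proj₁ u xor proj₁ v) , (proj₂ u xor proj₂ v))
                                ≡ kernel-element u · kernel-element v
  kernel-element-xor (u , v) (u′ , v′) = begin
    aᵐ^ (u xor u′) · B (v xor v′)      ≡⟨ cong₂ _·_ (aᵐ^-xor u u′) ([a⁻¹b]^-xor v v′) ⟩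
    (aᵐ^ u · aᵐ^ u′) · (B v · B v′)    ≡⟨ ·-assoc (aᵐ^ u) (aᵐ^ u′) _ ⟩
    aᵐ^ u · (aᵐ^ u′ · (B v · B v′))    ≡⟨ cong (aᵐ^ u ·_) (sym (·-assoc (aᵐ^ u′) (B v) (B v′))) ⟩
    aᵐ^ u · ((aᵐ^ u′ · B v) · B v′)    ≡⟨ cong (λ g → aᵐ^ u · (g · B v′)) (aᵐ^-central u′ (B v)) ⟩
    aᵐ^ u · ((B v · aᵐ^ u′) · B v′)    ≡⟨ cong (aᵐ^ u ·_) (·-assoc (B v) (aᵐ^ u′) (B v′)) ⟩
    aᵐ^ u · (B v · (aᵐ^ u′ · B v′))    ≡⟨ sym (·-assoc (aᵐ^ u) (B v) _) ⟩
    (aᵐ^ u · B v) · (aᵐ^ u′ · B v′)    ∎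
    where
    open ≡-Reasoning
    B = [a⁻¹b]^

  aᵐ^-injective : ∀ u u′ → aᵐ^ u ≡ aᵐ^ u′ → u ≡ u′
  aᵐ^-injective false false _  = refl
  aᵐ^-injective false true  eq = contradiction (cong proj₁ eq) z0≢m'
  aᵐ^-injective true  false eq = contradiction (sym (cong proj₁ eq)) z0≢m'
  aᵐ^-injective true  true  _  = refl

  kernel-element-bit : ∀ u v → proj₂ (kernel-element (u , v)) ≡ v
  kernel-element-bit u false = refl
  kernel-element-bit u true  = refl

  kernel-element-injective : ∀ u v → kernel-element u ≡ kernel-element v → u ≡ v
  kernel-element-injective (u , v) (u′ , v′) eq = cong₂ _,_ u≡u′ v≡v′
    where
    v≡v′ : v ≡ v′
    v≡v′ = trans (sym (kernel-element-bit u v)) (trans (cong proj₂ eq) (kernel-element-bit u′ v′))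
    u≡u′ : u ≡ u′
    u≡u′ = aᵐ^-injective u u′ (∙-cancelʳ ([a⁻¹b]^ v) (aᵐ^ u) (aᵐ^ u′)
             (trans eq (cong (λ w → aᵐ^ u′ · [a⁻¹b]^ w) (sym v≡v′))))

  πₙ-kernel-element : ∀ u → πₙ (kernel-element u) ≡ z1
  πₙ-kernel-element (false , false) =
    solve 0 (((:0 :+ :0) :+ (:0 :+ :0)) :+ :1 := :1) refl
  πₙ-kernel-element (true , false) = begin
    ((m' ⊕ z0) ⊕ (m' ⊕ z0)) ⊕ z1
      ≡⟨ solve 1 (λ u → ((u :+ :0) :+ (u :+ :0)) :+ :1 := (u :+ u) :+ :1) refl m' ⟩
    (m' ⊕ m') ⊕ z1                   ≡⟨ cong (_⊕ z1) m'⊕m' ⟩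
    z0 ⊕ z1                          ≡⟨ solve 0 (:0 :+ :1 := :1) refl ⟩
    z1                               ∎
    where open ≡-Reasoning
  πₙ-kernel-element (false , true) =
    solve 0 (:- (((:0 :- :1) :+ (:0 :- :1)) :+ :1) := :1) refl
  πₙ-kernel-element (true , true) = begin
    ⊖ (((m' ⊕ (⊖ z1)) ⊕ (m' ⊕ (⊖ z1))) ⊕ z1)
      ≡⟨ solve 1 (λ u → :- (((u :- :1) :+ (u :- :1)) :+ :1) := :1 :- (u :+ u)) refl m' ⟩
    z1 ⊕ (⊖ (m' ⊕ m'))                         ≡⟨ cong (λ k → z1 ⊕ (⊖ k)) m'⊕m' ⟩
    z1 ⊕ (⊖ z0)                                ≡⟨ solve 0 (:1 :- :0 := :1) refl ⟩
    z1                                         ∎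
    where open ≡-Reasoning

  kernel-element-surjective : ∀ g → πₙ g ≡ z1 → Σ (Bool × Bool) (λ u → kernel-element u ≡ g)
  kernel-element-surjective (j , false) πₙ≡z1 = rotation (halves-of-zero j (begin
    j ⊕ j                     ≡⟨ solve 1 (λ j → j :+ j := ((j :+ j) :+ :1) :- :1) refl j ⟩
    πₙ (j , false) ⊕ (⊖ z1)   ≡⟨ cong (_⊕ (⊖ z1)) πₙ≡z1 ⟩
    z1 ⊕ (⊖ z1)               ≡⟨ solve 0 (:1 :- :1 := :0) refl ⟩
    z0                        ∎))
    where
    open ≡-Reasoning
    rotation : j ≡ z0 ⊎ j ≡ m' → Σ (Bool × Bool) (λ u → kernel-element u ≡ (j , false))
    rotation (inj₁ j≡z0) = (false , false) ,
      cong (_, false) (trans (solve 0 (:0 :+ :0 := :0) refl) (sym j≡z0))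
    rotation (inj₂ j≡m') = (true , false) ,
      cong (_, false) (trans (solve 1 (λ u → u :+ :0 := u) refl m') (sym j≡m'))
  kernel-element-surjective (j , true) πₙ≡z1 = reflection (halves-of-zero (j ⊕ z1) (begin
    (j ⊕ z1) ⊕ (j ⊕ z1)
      ≡⟨ solve 1 (λ j → (j :+ :1) :+ (j :+ :1) := :1 :- (:- ((j :+ j) :+ :1))) refl j ⟩
    z1 ⊕ (⊖ πₙ (j , true))    ≡⟨ cong (λ k → z1 ⊕ (⊖ k)) πₙ≡z1 ⟩
    z1 ⊕ (⊖ z1)               ≡⟨ solve 0 (:1 :- :1 := :0) refl ⟩
    z0                        ∎))
    where
    open ≡-Reasoning
    reflection : j ⊕ z1 ≡ z0 ⊎ j ⊕ z1 ≡ m' → Σ (Bool × Bool) (λ u → kernel-element u ≡ (j , true))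
    reflection (inj₁ j+1≡z0) =
      (false , true) , cong (_, true) (sym (trans (sym (+1-1 j)) (cong (_⊕ (⊖ z1)) j+1≡z0)))
    reflection (inj₂ j+1≡m') =
      (true , true) , cong (_, true) (sym (trans (sym (+1-1 j)) (cong (_⊕ (⊖ z1)) j+1≡m')))
  π₀-range : ∀ k → (Σ G (λ g → π₀ g ≡ k)) ⇔ (Σ ℕ (λ i → i < m × k ≡ 2 * i + 1))
  π₀-range k = mk⇔ to from
    where
    to : Σ G (λ g → π₀ g ≡ k) → Σ ℕ (λ i → i < m × k ≡ 2 * i + 1)
    to (g , refl) = i , ℕ.*-cancelˡ-< 2 i m (ℕ.<-trans (ℕ.n<1+n (2 * i)) 2i+1<n) , a≡2i+1
      where
      a = π₀ g
      i = a / 2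
      a≡2i+1 : a ≡ 2 * i + 1
      a≡2i+1 = begin
        a                 ≡⟨ m≡m%n+[m/n]*n a 2 ⟩
        a % 2 + i * 2     ≡⟨ cong (_+ i * 2) (odd⇒%2≡1 (πₙ g) (πₙ-odd g)) ⟩
        1 + i * 2         ≡⟨ ℕ.+-comm 1 (i * 2) ⟩
        i * 2 + 1         ≡⟨ cong (_+ 1) (ℕ.*-comm i 2) ⟩
        2 * i + 1         ∎
        where open ≡-Reasoning
      2i+1<n : suc (2 * i) < n
      2i+1<n = subst (_< n) (trans a≡2i+1 (ℕ.+-comm (2 * i) 1)) (toℕ<n (πₙ g))
    from : Σ ℕ (λ i → i < m × k ≡ 2 * i + 1) → Σ G (λ g → π₀ g ≡ k)
    from (i , i<m , refl) = a^ (i mod n) , (begin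
      toℕ (((i mod n) ⊕ (i mod n)) ⊕ z1)   ≡⟨ cong (λ c → toℕ (c ⊕ z1)) (sym (mod-homo-+ i i)) ⟩
      toℕ (((i + i) mod n) ⊕ z1)           ≡⟨ cong toℕ (sym (mod-homo-+ (i + i) 1)) ⟩
      toℕ ((i + i + 1) mod n)
        ≡⟨ cong (λ a → toℕ ((i + a + 1) mod n)) (sym (ℕ.+-identityʳ i)) ⟩
      toℕ ((2 * i + 1) mod n)              ≡⟨ toℕ-mod-< 2i+1<n ⟩
      2 * i + 1                            ∎)
      where
      open ≡-Reasoning
      2i+1<n : 2 * i + 1 < n
      2i+1<n = subst (_≤ n) (trans (ℕ.*-suc 2 i) (cong suc (sym (ℕ.+-comm (2 * i) 1)))) (ℕ.*-monoʳ-≤ 2 i<m)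

  -- Both sides depend only on j modulo 4, so it suffices to check the four residues in ℤ/4.
  π₀-mod-4-at : 4 ∣ n → ∀ j s → (π₀ (j , s) % 4 ≡ 3) ⇔ (isEven j ≡ s)
  π₀-mod-4-at 4∣n j s =
    subst₂ (λ a b → (a ≡ 3) ⇔ (b ≡ s)) (sym π₀%4) (sym isEven≡) (table (reduce j) s)
    where
    open Reduction n 4 4∣n using (reduce; reduce-+; reduce-neg; reduce-mod)
    module ℤ₄ = Residues 4
    π₄ : Fin 4 → Bool → Fin 4
    π₄ r false = (r ℤ₄.+ₙ r) ℤ₄.+ₙ ℤ₄.1ₙ
    π₄ r true  = ℤ₄.-ₙ ((r ℤ₄.+ₙ r) ℤ₄.+ₙ ℤ₄.1ₙ)
    reduce-πₙ : ∀ s → reduce (πₙ (j , s)) ≡ π₄ (reduce j) s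
    reduce-πₙ false = trans (reduce-+ (j ⊕ j) z1) (cong₂ ℤ₄._+ₙ_ (reduce-+ j j) (reduce-mod 1))
    reduce-πₙ true  = trans (reduce-neg ((j ⊕ j) ⊕ z1)) (cong ℤ₄.-ₙ_ (reduce-πₙ false))
    π₀%4 : π₀ (j , s) % 4 ≡ toℕ (π₄ (reduce j) s)
    π₀%4 = trans (sym (ℤ₄.toℕ-mod (π₀ (j , s)))) (cong toℕ (reduce-πₙ s))
    isEven≡ : isEven j ≡ (toℕ (reduce j) % 2 ≡ᵇ 0)
    isEven≡ = cong (_≡ᵇ 0) (trans (sym (m∣n⇒o%n%m≡o%m 2 4 (toℕ j) (divides 2 refl)))
                                  (cong (_% 2) (sym (ℤ₄.toℕ-mod (toℕ j)))))
    table : ∀ r s → (toℕ (π₄ r s) ≡ 3) ⇔ ((toℕ r % 2 ≡ᵇ 0) ≡ s)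
    table zero                         false = mk⇔ (λ ()) (λ ())
    table zero                         true  = mk⇔ (λ _ → refl) (λ _ → refl)
    table (suc zero)                   false = mk⇔ (λ _ → refl) (λ _ → refl)
    table (suc zero)                   true  = mk⇔ (λ ()) (λ ())
    table (suc (suc zero))             false = mk⇔ (λ ()) (λ ())
    table (suc (suc zero))             true  = mk⇔ (λ _ → refl) (λ _ → refl)
    table (suc (suc (suc zero)))       false = mk⇔ (λ _ → refl) (λ _ → refl)
    table (suc (suc (suc zero)))       true  = mk⇔ (λ ()) (λ ())

  π₀-mod-4 : 4 ∣ n → ∀ g → (π₀ g % 4 ≡ 3) ⇔ InX g
  π₀-mod-4 4∣n (j , false) = π₀-mod-4-at 4∣n j false
  π₀-mod-4 4∣n (j , true)  = π₀-mod-4-at 4∣n j true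

  power-function-kernel : ∀ {π} → IsSkew ψ₀ π → KerIsoZ2² π
  power-function-kernel {π} π-skew =
    kernel-element , kernel-element-injective , in-kernel , onto-kernel , kernel-element-xor
    where
    π≗π₀ = power-function-unique π-skew
    in-kernel : ∀ u → π (kernel-element u) ≡ 1
    in-kernel u = trans (π≗π₀ (kernel-element u))
      (Equivalence.from (π₀≡1⇔πₙ≡z1 (kernel-element u)) (πₙ-kernel-element u))
    onto-kernel : ∀ g → π g ≡ 1 → Σ (Bool × Bool) (λ u → kernel-element u ≡ g)
    onto-kernel g πg≡1 =
      kernel-element-surjective g (Equivalence.to (π₀≡1⇔πₙ≡z1 g) (trans (sym (π≗π₀ g)) πg≡1))

  power-function-range : ∀ {π} → IsSkew ψ₀ π → ∀ k →
                         (Σ G (λ g → π g ≡ k)) ⇔ (Σ ℕ (λ i → i < m × k ≡ 2 * i + 1))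
  power-function-range {π} π-skew k = mk⇔
    (λ (g , πg≡k) → Equivalence.to (π₀-range k) (g , trans (sym (π≗π₀ g)) πg≡k))
    (λ odd → let (g , π₀g≡k) = Equivalence.from (π₀-range k) odd in g , trans (π≗π₀ g) π₀g≡k)
    where π≗π₀ = power-function-unique π-skew

  power-function-mod-4 : ∀ {π} → IsSkew ψ₀ π → 4 ∣ n → ∀ g → (π g % 4 ≡ 3) ⇔ InX g
  power-function-mod-4 {π} π-skew 4∣n g =
    subst (λ a → (a % 4 ≡ 3) ⇔ InX g) (sym (power-function-unique π-skew g)) (π₀-mod-4 4∣n g)

lemma4p4 : (m : ℕ) .{{_ : NonZero m}} → 3 ≤ m →
  let open Dn m in
    -- (1) M is regular and its associated skew-morphism is ψ₀
    (Regular × IsAssociated ψ₀)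
    -- (2) the core L(N) of L(C_n) in Aut(M): |N| ≤ 2, and |N| = 1 iff m odd
  × (Σ (Fin n → Set) IsCore)
  × (∀ (N : Fin n → Set) → IsCore N →
        (∀ c₁ c₂ c₃ → N c₁ → N c₂ → N c₃ → (c₁ ≡ c₂ ⊎ c₁ ≡ c₃ ⊎ c₂ ≡ c₃))
      × ((Σ (Fin n) (λ c → N c × (∀ c′ → N c′ → c′ ≡ c))) ⇔ (¬ (2 ∣ m))))
    -- (3), (4) for the associated power function π of ψ₀
  × (∀ (π : G → ℕ) → IsSkew ψ₀ π →
        KerIsoZ2² π
      × (∀ k → (Σ G (λ g → π g ≡ k)) ⇔ (Σ ℕ (λ i → i < m × k ≡ 2 * i + 1)))
      × (4 ∣ n → ∀ (g : G) → (π g % 4 ≡ 3) ⇔ InX g))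
lemma4p4 m _ =
    (regular , ψ₀-associated)
  , (N₀ , N₀-isCore)
  , (λ N N-core → core-at-most-two N N-core , core-trivial⇔m-odd N N-core)
  , λ π π-skew → power-function-kernel π-skew , power-function-range π-skew , power-function-mod-4 π-skew
  where open Dihedral m
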